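{- Let $q$ be a prime power and let $\pi$ be an order-$q$-subplane of $\mathrm{PG}(2,q^3)$ meeting the line $\ell_\infty$ in exactly one point $T$, with tangent splash $\mathscr{S}_T$. (1) For each point $P\in\pi$ with $P\neq T$, the set $t_P$ of points of $\ell_\infty$ lying on (the extensions to $\mathrm{PG}(2,q^3)$ of) the $q+1$ lines of $\pi$ through $P$ is an order-$q$-subline of $\ell_\infty$ that contains $T$ and is contained in $\mathscr{S}_T$. Moreover, $P\mapsto t_P$ is a bijection between the $q^2+q$ points of $\pi\setminus\{T\}$ and the set of order-$q$-sublines of $\ell_\infty$ that contain $T$ and are contained in $\mathscr{S}_T$. (2) If $U,V$ are distinct points of $\mathscr{S}_T\setminus\{T\}$, then the unique order-$q$-subline of $\ell_\infty$ containing $T,U,V$ is contained in $\mathscr{S}_T$.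
   Context: An order-$q$-subplane of $\mathrm{PG}(2,q^3)$ is a subplane of order $q$, equivalently an image of $\mathrm{PG}(2,q)$ under $\mathrm{PGL}(3,q^3)$. An order-$q$-subline of a line of $\mathrm{PG}(2,q^3)$ is an image of $\mathrm{PG}(1,q)=\{(a,1):a\in\mathrm{GF}(q)\}\cup\{(1,0)\}$ under $\mathrm{PGL}(2,q^3)$; any three distinct points of a line lie in a unique order-$q$-subline. A fixed line $\ell_\infty$ of $\mathrm{PG}(2,q^3)$ is called the line at infinity; points not on it are affine. If $\pi$ is an order-$q$-subplane meeting $\ell_\infty$ in exactly one point $T$, its tangent splash $\mathscr{S}_T$ is the set of points of $\ell_\infty$ lying on the extension to $\mathrm{PG}(2,q^3)$ of some line of $\pi$; it has $q^2+1$ points, and $T$ is called its centre. -}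

module Defs where

open import Level using (Level; _⊔_) renaming (suc to lsuc)
open import Data.Nat using (ℕ; _^_; _≤_)
open import Data.Nat.Primality using (Prime)
open import Data.Fin using (Fin)
open import Data.Product using (Σ; ∃; _×_; _,_)
open import Relation.Nullary using (¬_)
open import Relation.Binary.PropositionalEquality using (_≡_)
open import Algebra.Bundles using (CommutativeRing)

IsPrimePower : ℕ → Set
IsPrimePower q = Σ ℕ λ p → Σ ℕ λ k → Prime p × 1 ≤ k × q ≡ p ^ k

module Geometry {c ℓ : Level} (R : CommutativeRing c ℓ) where
  open CommutativeRing R

  IsField : Set (c ⊔ ℓ)
  IsField = (¬ 1# ≈ 0#) × (∀ x → ¬ x ≈ 0# → ∃ λ y → x * y ≈ 1#)

  HasSize : ℕ → Set (c ⊔ ℓ)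
  HasSize n = Σ (Fin n → Carrier) λ e →
    (∀ i j → e i ≈ e j → i ≡ j) × (∀ x → ∃ λ i → e i ≈ x)

  IsSubfield : ∀ {k} → (Carrier → Set k) → Set (c ⊔ ℓ ⊔ k)
  IsSubfield K =
    (∀ x y → x ≈ y → K x → K y) × K 0# × K 1#
    × (∀ x y → K x → K y → K (x + y)) × (∀ x → K x → K (- x))
    × (∀ x y → K x → K y → K (x * y))
    × (∀ x y → K x → ¬ x ≈ 0# → x * y ≈ 1# → K y)

  SubHasSize : ∀ {k} → (Carrier → Set k) → ℕ → Set (c ⊔ ℓ ⊔ k)
  SubHasSize K n = Σ (Fin n → Carrier) λ e →
    (∀ i → K (e i)) × (∀ i j → e i ≈ e j → i ≡ j)
    × (∀ x → K x → ∃ λ i → e i ≈ x)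

  -- Homogeneous coordinates of PG(2,R) and PG(1,R)
  V3 : Set c
  V3 = Carrier × Carrier × Carrier

  V2 : Set c
  V2 = Carrier × Carrier

  -- 3x3 matrices as triples of rows; 2x2 matrices as pairs of rows
  Mat3 : Set c
  Mat3 = V3 × V3 × V3

  Mat2 : Set c
  Mat2 = V2 × V2

  dot3 : V3 → V3 → Carrier
  dot3 (a , b , d) (x , y , z) = a * x + b * y + d * z

  dot2 : V2 → V2 → Carrier
  dot2 (a , b) (x , y) = a * x + b * y

  app3 : Mat3 → V3 → V3
  app3 (r₁ , r₂ , r₃) v = dot3 r₁ v , dot3 r₂ v , dot3 r₃ v

  app2 : Mat2 → V2 → V2
  app2 (r₁ , r₂) v = dot2 r₁ v , dot2 r₂ v

  det3 : Mat3 → Carrier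
  det3 ((a , b , d) , (e , f , g) , (h , i , j)) =
    a * (f * j - g * i) - b * (e * j - g * h) + d * (e * i - f * h)

  det2 : Mat2 → Carrier
  det2 ((a , b) , (d , e)) = a * e - b * d

  -- element of PGL(3,R) / PGL(2,R) (represented by an invertible matrix)
  Invertible3 : Mat3 → Set ℓ
  Invertible3 M = ¬ det3 M ≈ 0#

  Invertible2 : Mat2 → Set ℓ
  Invertible2 N = ¬ det2 N ≈ 0#

  NonZero3 : V3 → Set ℓ
  NonZero3 (x , y , z) = ¬ (x ≈ 0# × y ≈ 0# × z ≈ 0#)

  NonZero2 : V2 → Set ℓ
  NonZero2 (x , y) = ¬ (x ≈ 0# × y ≈ 0#)

  _∼_ : V3 → V3 → Set (c ⊔ ℓ)
  (x , y , z) ∼ (x' , y' , z') =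
    ∃ λ t → ¬ t ≈ 0# × x ≈ t * x' × y ≈ t * y' × z ≈ t * z'

  Incident : V3 → V3 → Set ℓ
  Incident L X = dot3 L X ≈ 0#

  OnInf : V3 → Set ℓ
  OnInf (x , y , z) = NonZero3 (x , y , z) × z ≈ 0#

  module Sub {k} (K : Carrier → Set k) where

    InK3 : V3 → Set k
    InK3 (x , y , z) = K x × K y × K z

    InK2 : V2 → Set k
    InK2 (x , y) = K x × K y

    -- X is a point of the order-q-subplane π = M(PG(2,K))
    InPi : Mat3 → V3 → Set (c ⊔ ℓ ⊔ k)
    InPi M X = NonZero3 X × ∃ λ v → InK3 v × NonZero3 v × X ∼ app3 M v

    LineOfPi : Mat3 → V3 → Set (c ⊔ ℓ ⊔ k)
    LineOfPi M L = NonZero3 L × ∃ λ X → ∃ λ Y →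
      InPi M X × InPi M Y × ¬ X ∼ Y × Incident L X × Incident L Y

    MeetsInfExactlyAt : Mat3 → V3 → Set (c ⊔ ℓ ⊔ k)
    MeetsInfExactlyAt M T =
      InPi M T × OnInf T × (∀ X → InPi M X → OnInf X → X ∼ T)

    Splash : Mat3 → V3 → Set (c ⊔ ℓ ⊔ k)
    Splash M X = OnInf X × ∃ λ L → LineOfPi M L × Incident L X

    tP : Mat3 → V3 → V3 → Set (c ⊔ ℓ ⊔ k)
    tP M P X = OnInf X × ∃ λ L → LineOfPi M L × Incident L P × Incident L X

    -- the order-q-subline N(PG(1,K)) of ℓ∞ (ℓ∞ coordinatised by (x,y) ↦ (x,y,0))
    OnSubline : Mat2 → V3 → Set (c ⊔ ℓ ⊔ k)
    OnSubline N X = NonZero3 X × ∃ λ w → InK2 w × NonZero2 w ×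
      (let (a , b) = app2 N w in X ∼ (a , b , 0#))

    SameSet : ∀ {a b} → (V3 → Set a) → (V3 → Set b) → Set (c ⊔ a ⊔ b)
    SameSet A B = ∀ X → (A X → B X) × (B X → A X)

    Subset : ∀ {a b} → (V3 → Set a) → (V3 → Set b) → Set (c ⊔ a ⊔ b)
    Subset A B = ∀ X → A X → B X

    Part1 : Mat3 → V3 → Set (c ⊔ ℓ ⊔ k)
    Part1 M T =
      (∀ P → InPi M P → ¬ P ∼ T →
          (∃ λ N → Invertible2 N × SameSet (tP M P) (OnSubline N))
          × tP M P T × Subset (tP M P) (Splash M))
      × (∀ P Q → InPi M P → InPi M Q → ¬ P ∼ T → ¬ Q ∼ T →
          SameSet (tP M P) (tP M Q) → P ∼ Q)
      × (∀ N → Invertible2 N → OnSubline N T → Subset (OnSubline N) (Splash M) →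
          ∃ λ P → InPi M P × ¬ P ∼ T × SameSet (tP M P) (OnSubline N))

    Part2 : Mat3 → V3 → Set (c ⊔ ℓ ⊔ k)
    Part2 M T = ∀ U V → Splash M U → Splash M V → ¬ U ∼ T → ¬ V ∼ T → ¬ U ∼ V →
      ∀ N → Invertible2 N → OnSubline N T → OnSubline N U → OnSubline N V →
      Subset (OnSubline N) (Splash M)

-- Take coordinates with π = M(PG(2,K)) and ℓ∞ : z = 0. A point P = M p of π other than T is
-- off ℓ∞, and a line of π through P is P ∨ M u with u ∈ K³; it meets ℓ∞ in M(ρ(u) p − ρ(p) u),
-- where ρ is the third row of M. This projection is K-linear in u, so, completing p to a basis
-- p, a, b of K³, Cramer's rule shows that t_P = N(PG(1,K)) for the 2×2 matrix N whose columns
-- are the projections of a and b.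
-- Two points U, V ≠ T of the splash lie on lines of π meeting in a point P ∈ π \ {T}, so t_P
-- is an order-q-subline through T, U, V. A subline is determined by three of its points
-- (coordinates of the third point with respect to the other two lie in K), which gives (2)
-- and the surjectivity of P ↦ t_P. If t_P = t_Q with P ≠ Q, a point of t_P off the line PQ
-- lies on two lines of π, hence in π ∩ ℓ∞ = {T}; so t_P ⊆ {T} ∪ (PQ ∩ ℓ∞), too few points for
-- a subline.

module Submission where

open import Defs
open import Level using (Level; 0ℓ; _⊔_)
open import Data.Nat as ℕ using (ℕ; zero; suc; _^_)
import Data.Nat.Properties as ℕ
open import Data.Integer as ℤ using (ℤ; +_; -[1+_]; _⊖_)
import Data.Integer.Properties as ℤ
open import Data.Sign as Sign using (Sign)
open import Data.Fin as Fin using (Fin; zero; suc)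
open import Data.Maybe using (Maybe; just; nothing)
open import Data.Product using (Σ; ∃; ∃₂; _×_; _,_; proj₁; proj₂)
open import Data.Sum using (_⊎_; inj₁; inj₂)
open import Data.Empty using (⊥; ⊥-elim)
open import Data.Vec using (Vec; allFin; map)
open import Data.Vec.N-ary using (N-ary; Eq; Eqʰ; curryⁿ; curryⁿ-cong; curryⁿ-cong⁻¹; Eqʰ-to-Eq; _$ⁿ_)
open import Relation.Nullary using (¬_; Dec; yes; no)
open import Relation.Nullary.Decidable using (decidable-stable)
open import Relation.Binary.Bundles using (Setoid)
open import Relation.Binary.Definitions using (Decidable)
import Relation.Binary.Reasoning.Setoid as SetoidReasoning
open import Relation.Binary.PropositionalEquality as ≡ using (_≡_)
open import Algebra.Bundles using (CommutativeRing)
open import Algebra.Bundles.Raw using (RawRing)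
open import Algebra.Solver.Ring.AlmostCommutativeRing using (fromCommutativeRing; _-Raw-AlmostCommutative⟶_)

-- ℤ maps into every commutative ring, and with integer coefficients the solver's normal forms
-- can be compared by evaluation.
module IntegerSolver {c ℓ : Level} (R : CommutativeRing c ℓ) where
  open CommutativeRing R
  open import Relation.Binary.Reasoning.Setoid setoid
  open import Algebra.Properties.Semiring.Mult semiring using (×-homo-+; ×1-homo-*)
    renaming (_×_ to _⨰_)
  open import Algebra.Properties.Ring ring using (-1*x≈-x; -‿involutive)
  open import Algebra.Properties.AbelianGroup +-abelianGroup using (⁻¹-∙-comm; ε⁻¹≈ε)
  open import Algebra.Properties.CommutativeSemigroup +-commutativeSemigroup
    using () renaming (interchange to +-interchange)
  open import Algebra.Properties.CommutativeSemigroup *-commutativeSemigroup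
    using () renaming (interchange to *-interchange)

  fromℕ : ℕ → Carrier
  fromℕ n = n ⨰ 1#

  fromℤ : ℤ → Carrier
  fromℤ (+ n)    = fromℕ n
  fromℤ -[1+ n ] = - fromℕ (suc n)

  fromℤ-⊖ : ∀ m n → fromℤ (m ⊖ n) ≈ fromℕ m - fromℕ n
  fromℤ-⊖ m zero = begin
    fromℕ m           ≈⟨ +-identityʳ _ ⟨
    fromℕ m + 0#      ≈⟨ +-congˡ ε⁻¹≈ε ⟨
    fromℕ m - 0#      ∎
  fromℤ-⊖ zero (suc n) = sym (+-identityˡ _)
  fromℤ-⊖ (suc m) (suc n) = begin
    fromℤ (suc m ⊖ suc n)                ≡⟨ ≡.cong fromℤ (ℤ.[1+m]⊖[1+n]≡m⊖n m n) ⟩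
    fromℤ (m ⊖ n)                        ≈⟨ fromℤ-⊖ m n ⟩
    fromℕ m - fromℕ n                    ≈⟨ cancel 1# (fromℕ m) (fromℕ n) ⟨
    (1# + fromℕ m) - (1# + fromℕ n)      ∎
    where
    cancel : ∀ x y z → (x + y) - (x + z) ≈ y - z
    cancel x y z = begin
      (x + y) + - (x + z)     ≈⟨ +-congˡ (⁻¹-∙-comm x z) ⟨
      (x + y) + (- x + - z)   ≈⟨ +-interchange x y (- x) (- z) ⟩
      (x - x) + (y - z)       ≈⟨ +-congʳ (-‿inverseʳ x) ⟩
      0# + (y - z)            ≈⟨ +-identityˡ _ ⟩
      y - z                   ∎

  fromℤ-+ : ∀ i j → fromℤ (i ℤ.+ j) ≈ fromℤ i + fromℤ j
  fromℤ-+ (+ m)    (+ n)    = ×-homo-+ 1# m n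
  fromℤ-+ (+ m)    -[1+ n ] = fromℤ-⊖ m (suc n)
  fromℤ-+ -[1+ m ] (+ n)    = trans (fromℤ-⊖ n (suc m)) (+-comm _ _)
  fromℤ-+ -[1+ m ] -[1+ n ] = begin
    - fromℕ (suc (suc (m ℕ.+ n)))            ≡⟨ ≡.cong (λ k → - fromℕ k) shift ⟩
    - fromℕ (suc m ℕ.+ suc n)                 ≈⟨ -‿cong (×-homo-+ 1# (suc m) (suc n)) ⟩
    - (fromℕ (suc m) + fromℕ (suc n))        ≈⟨ ⁻¹-∙-comm _ _ ⟨
    - fromℕ (suc m) + - fromℕ (suc n)         ∎
      where
      shift : suc (suc (m ℕ.+ n)) ≡ suc m ℕ.+ suc n
      shift = ≡.cong suc (≡.sym (ℕ.+-suc m n))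

  fromℤ-neg : ∀ i → fromℤ (ℤ.- i) ≈ - fromℤ i
  fromℤ-neg (+ zero)  = sym ε⁻¹≈ε
  fromℤ-neg (+ suc n) = refl
  fromℤ-neg -[1+ n ]  = sym (-‿involutive _)

  fromSign : Sign → Carrier
  fromSign Sign.+ = 1#
  fromSign Sign.- = - 1#

  fromSign-* : ∀ s t → fromSign (s Sign.* t) ≈ fromSign s * fromSign t
  fromSign-* Sign.+ t       = sym (*-identityˡ _)
  fromSign-* Sign.- Sign.+ = sym (*-identityʳ _)
  fromSign-* Sign.- Sign.- = begin
    1#                 ≈⟨ -‿involutive 1# ⟨
    - - 1#             ≈⟨ -1*x≈-x (- 1#) ⟨
    - 1# * - 1#        ∎

  fromℤ-◃ : ∀ s n → fromℤ (s ℤ.◃ n) ≈ fromSign s * fromℕ n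
  fromℤ-◃ s       zero    = sym (zeroʳ _)
  fromℤ-◃ Sign.+ (suc n) = sym (*-identityˡ _)
  fromℤ-◃ Sign.- (suc n) = sym (-1*x≈-x _)

  fromℤ-signAbs : ∀ i → fromℤ i ≈ fromSign (ℤ.sign i) * fromℕ ℤ.∣ i ∣
  fromℤ-signAbs (+ n)    = sym (*-identityˡ _)
  fromℤ-signAbs -[1+ n ] = sym (-1*x≈-x _)

  fromℤ-* : ∀ i j → fromℤ (i ℤ.* j) ≈ fromℤ i * fromℤ j
  fromℤ-* i j = begin
    fromℤ (s ℤ.◃ m ℕ.* n)                     ≈⟨ fromℤ-◃ s (m ℕ.* n) ⟩
    fromSign s * fromℕ (m ℕ.* n)               ≈⟨ *-cong (fromSign-* (ℤ.sign i) (ℤ.sign j)) (×1-homo-* m n) ⟩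
    (σ * τ) * (fromℕ m * fromℕ n)              ≈⟨ *-interchange σ τ (fromℕ m) (fromℕ n) ⟩
    (σ * fromℕ m) * (τ * fromℕ n)              ≈⟨ *-cong (fromℤ-signAbs i) (fromℤ-signAbs j) ⟨
    fromℤ i * fromℤ j                          ∎
    where
    s = ℤ.sign i Sign.* ℤ.sign j
    m = ℤ.∣ i ∣
    n = ℤ.∣ j ∣
    σ = fromSign (ℤ.sign i)
    τ = fromSign (ℤ.sign j)

  fromℤ-homomorphism : ℤ.+-*-rawRing -Raw-AlmostCommutative⟶ fromCommutativeRing R
  fromℤ-homomorphism = record
    { ⟦_⟧    = fromℤ
    ; +-homo = fromℤ-+
    ; *-homo = fromℤ-*
    ; -‿homo = fromℤ-neg
    ; 0-homo = refl
    ; 1-homo = +-identityʳ 1#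
    }

  fromℤ-≟ : ∀ i j → Maybe (fromℤ i ≈ fromℤ j)
  fromℤ-≟ i j with i ℤ.≟ j
  ... | yes ≡.refl = just refl
  ... | no _       = nothing

  open import Algebra.Solver.Ring ℤ.+-*-rawRing (fromCommutativeRing R) fromℤ-homomorphism fromℤ-≟ public

-- Instantiated at the carrier (where dot3, app3, det3, app2 and det2 agree definitionally with
-- those of Defs) and at the solver's polynomials, so that identities between vectors are proved
-- by the ring solver.
module RawVectors {a ℓ} (R : RawRing a ℓ) where
  open RawRing R using (_+_; _*_; -_; 0#) renaming (Carrier to A)

  infixl 7 _·_ _·₂_
  infixl 6 _⊕_ _⊕₂_

  _·_ : A → A × A × A → A × A × A
  s · (x , y , z) = s * x , s * y , s * z

  _⊕_ : A × A × A → A × A × A → A × A × A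
  (a₁ , a₂ , a₃) ⊕ (b₁ , b₂ , b₃) = a₁ + b₁ , a₂ + b₂ , a₃ + b₃

  dot3 : A × A × A → A × A × A → A
  dot3 (a₁ , a₂ , a₃) (b₁ , b₂ , b₃) = a₁ * b₁ + a₂ * b₂ + a₃ * b₃

  cross : A × A × A → A × A × A → A × A × A
  cross (a₁ , a₂ , a₃) (b₁ , b₂ , b₃) =
    a₂ * b₃ + - (a₃ * b₂) , a₃ * b₁ + - (a₁ * b₃) , a₁ * b₂ + - (a₂ * b₁)

  det : A × A × A → A × A × A → A × A × A → A
  det u v w = dot3 (cross u v) w

  app3 : (A × A × A) × (A × A × A) × (A × A × A) → A × A × A → A × A × A
  app3 (r₁ , r₂ , r₃) v = dot3 r₁ v , dot3 r₂ v , dot3 r₃ v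

  det3 : (A × A × A) × (A × A × A) × (A × A × A) → A
  det3 ((a , b , d) , (e , f , g) , (h , i , j)) =
    a * (f * j + - (g * i)) + - (b * (e * j + - (g * h))) + d * (e * i + - (f * h))

  -- the projection of u from the point p onto the plane dot3 r x = 0
  project : A × A × A → A × A × A → A × A × A → A × A × A
  project r p u = dot3 r u · p ⊕ - dot3 r p · u

  _·₂_ : A → A × A → A × A
  s ·₂ (x , y) = s * x , s * y

  _⊕₂_ : A × A → A × A → A × A
  (a₁ , a₂) ⊕₂ (b₁ , b₂) = a₁ + b₁ , a₂ + b₂

  cross₂ : A × A → A × A → A
  cross₂ (a₁ , a₂) (b₁ , b₂) = a₁ * b₂ + - (a₂ * b₁)

  app2 : (A × A) × (A × A) → A × A → A × A
  app2 ((a , b) , (d , e)) (x , y) = a * x + b * y , d * x + e * y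

  det2 : (A × A) × (A × A) → A
  det2 ((a , b) , (d , e)) = a * e + - (b * d)

  adj2 : (A × A) × (A × A) → A × A → A × A
  adj2 ((a , b) , (d , e)) (x , y) = e * x + - (b * y) , a * y + - (d * x)

  ℓ∞-point : (A × A) × (A × A) → A × A → A × A × A
  ℓ∞-point N w = proj₁ (app2 N w) , proj₂ (app2 N w) , 0#

module Coordinates {c ℓ : Level} (R : CommutativeRing c ℓ) where
  open CommutativeRing R
  open Geometry R
  open IntegerSolver R
  open RawVectors rawRing public
    using (_·_; _⊕_; cross; det; project; _·₂_; _⊕₂_; cross₂; adj2; ℓ∞-point)

  third : V3 → Carrier
  third (_ , _ , z) = z

  0ᵥ e₃ : V3
  0ᵥ = 0# , 0# , 0#
  e₃ = 0# , 0# , 1#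

  polynomialRawRing : ℕ → RawRing 0ℓ 0ℓ
  polynomialRawRing n = record
    { Carrier = Polynomial n ; _≈_ = _≡_ ; _+_ = _:+_ ; _*_ = _:*_ ; -_ = :-_
    ; 0# = con (+ 0) ; 1# = con (+ 1) }

  open module Poly {n} = RawVectors (polynomialRawRing n) public using () renaming
    ( _·_ to _:·_ ; _⊕_ to _:⊕_ ; dot3 to :dot3 ; cross to :cross ; det to :det
    ; app3 to :app3 ; det3 to :det3 ; project to :project
    ; _·₂_ to _:·₂_ ; _⊕₂_ to _:⊕₂_ ; cross₂ to :cross₂ ; app2 to :app2 ; det2 to :det2
    ; adj2 to :adj2 ; ℓ∞-point to :ℓ∞-point )

  :0 : ∀ {n} → Polynomial n
  :0 = con (+ 0)

  infix 4 _≋_ _≋₂_ _:≋_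

  _≋_ : V3 → V3 → Set ℓ
  (x , y , z) ≋ (x' , y' , z') = x ≈ x' × y ≈ y' × z ≈ z'

  _≋₂_ : V2 → V2 → Set ℓ
  (x , y) ≋₂ (x' , y') = x ≈ x' × y ≈ y'

  ≋-setoid : Setoid c ℓ
  ≋-setoid = record
    { Carrier = V3
    ; _≈_ = _≋_
    ; isEquivalence = record
      { refl  = refl , refl , refl
      ; sym   = λ (x , y , z) → sym x , sym y , sym z
      ; trans = λ (x , y , z) (x' , y' , z') → trans x x' , trans y y' , trans z z'
      }
    }

  open Setoid ≋-setoid public using () renaming (refl to ≋-refl; sym to ≋-sym; trans to ≋-trans)
  module ≈-Reasoning = SetoidReasoning setoid
  module ≋-Reasoning = SetoidReasoning ≋-setoid

  Poly³ : ℕ → Set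
  Poly³ n = Polynomial n × Polynomial n × Polynomial n

  _:≋_ : ∀ {n} → Poly³ n → Poly³ n → Poly³ n × Poly³ n
  _:≋_ = _,_

  ⟦_⟧³ ⟦_⟧↓³ : ∀ {n} → Poly³ n → Vec Carrier n → V3
  ⟦ p , q , r ⟧³  ρ = ⟦ p ⟧ ρ , ⟦ q ⟧ ρ , ⟦ r ⟧ ρ
  ⟦ p , q , r ⟧↓³ ρ = ⟦ p ⟧↓ ρ , ⟦ q ⟧↓ ρ , ⟦ r ⟧↓ ρ

  prove³ : ∀ {n} (ρ : Vec Carrier n) e₁ e₂ → ⟦ e₁ ⟧↓³ ρ ≋ ⟦ e₂ ⟧↓³ ρ → ⟦ e₁ ⟧³ ρ ≋ ⟦ e₂ ⟧³ ρ
  prove³ ρ (p , q , r) (p' , q' , r') (x , y , z) = prove ρ p p' x , prove ρ q q' y , prove ρ r r' z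

  solve³ : ∀ n (f : N-ary n (Polynomial n) (Poly³ n × Poly³ n)) →
    Eqʰ n _≋_ (curryⁿ ⟦ proj₁ (f $ⁿ map var (allFin n)) ⟧↓³) (curryⁿ ⟦ proj₂ (f $ⁿ map var (allFin n)) ⟧↓³) →
    Eq  n _≋_ (curryⁿ ⟦ proj₁ (f $ⁿ map var (allFin n)) ⟧³) (curryⁿ ⟦ proj₂ (f $ⁿ map var (allFin n)) ⟧³)
  solve³ n f hyp = curryⁿ-cong _≋_ ⟦ lhs ⟧³ ⟦ rhs ⟧³ λ ρ →
    prove³ ρ lhs rhs (curryⁿ-cong⁻¹ _≋_ ⟦ lhs ⟧↓³ ⟦ rhs ⟧↓³ (Eqʰ-to-Eq n _≋_ hyp) ρ)
    where
    lhs = proj₁ (f $ⁿ map var (allFin n))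
    rhs = proj₂ (f $ⁿ map var (allFin n))

  dot3-cong : ∀ {u u' v v'} → u ≋ u' → v ≋ v' → dot3 u v ≈ dot3 u' v'
  dot3-cong (a , b , d) (x , y , z) = +-cong (+-cong (*-cong a x) (*-cong b y)) (*-cong d z)

  cross-cong : ∀ {u u' v v'} → u ≋ u' → v ≋ v' → cross u v ≋ cross u' v'
  cross-cong (a , b , d) (x , y , z) =
    minus-cong (*-cong b z) (*-cong d y) , minus-cong (*-cong d x) (*-cong a z) , minus-cong (*-cong a y) (*-cong b x)
    where
    minus-cong : ∀ {w w' x x'} → w ≈ w' → x ≈ x' → w - x ≈ w' - x'
    minus-cong e f = +-cong e (-‿cong f)

  ·-cong : ∀ {s s' u u'} → s ≈ s' → u ≋ u' → s · u ≋ s' · u'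
  ·-cong e (x , y , z) = *-cong e x , *-cong e y , *-cong e z

  ⊕-cong : ∀ {u u' v v'} → u ≋ u' → v ≋ v' → u ⊕ v ≋ u' ⊕ v'
  ⊕-cong (a , b , d) (x , y , z) = +-cong a x , +-cong b y , +-cong d z

  app3-cong : ∀ N {u u'} → u ≋ u' → app3 N u ≋ app3 N u'
  app3-cong (r₁ , r₂ , r₃) e = dot3-cong ≋-refl e , dot3-cong ≋-refl e , dot3-cong ≋-refl e

  ·-assoc : ∀ s t u → s · (t · u) ≋ (s * t) · u
  ·-assoc s t (a , b , d) = sym (*-assoc s t a) , sym (*-assoc s t b) , sym (*-assoc s t d)

  ·-comm : ∀ s t u → s · (t · u) ≋ t · (s · u)
  ·-comm s t u = ≋-trans (·-assoc s t u) (≋-trans (·-cong (*-comm s t) ≋-refl) (≋-sym (·-assoc t s u)))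

  ·-identityˡ : ∀ u → 1# · u ≋ u
  ·-identityˡ (a , b , d) = *-identityˡ a , *-identityˡ b , *-identityˡ d

  ·-zeroʳ : ∀ t → t · 0ᵥ ≋ 0ᵥ
  ·-zeroʳ t = zeroʳ t , zeroʳ t , zeroʳ t

  ·-⊕-zero : ∀ A B → 0# · A ⊕ 0# · B ≋ 0ᵥ
  ·-⊕-zero (a₁ , a₂ , a₃) (b₁ , b₂ , b₃) = solve³ 6
    (λ a₁ a₂ a₃ b₁ b₂ b₃ → :0 :· (a₁ , a₂ , a₃) :⊕ :0 :· (b₁ , b₂ , b₃) :≋ (:0 , :0 , :0))
    (refl , refl , refl) a₁ a₂ a₃ b₁ b₂ b₃

  ·-distrib-⊕ : ∀ k s A t B → k · (s · A ⊕ t · B) ≋ (k * s) · A ⊕ (k * t) · B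
  ·-distrib-⊕ k s (a₁ , a₂ , a₃) t (b₁ , b₂ , b₃) = solve³ 9
    (λ k s a₁ a₂ a₃ t b₁ b₂ b₃ → let A = a₁ , a₂ , a₃ ; B = b₁ , b₂ , b₃ in
      k :· (s :· A :⊕ t :· B) :≋ (k :* s) :· A :⊕ (k :* t) :· B)
    (refl , refl , refl) k s a₁ a₂ a₃ t b₁ b₂ b₃

  dot3-·ʳ : ∀ L t X → dot3 L (t · X) ≈ t * dot3 L X
  dot3-·ʳ (l₁ , l₂ , l₃) t (x₁ , x₂ , x₃) = solve 7
    (λ l₁ l₂ l₃ t x₁ x₂ x₃ → let L = l₁ , l₂ , l₃ ; X = x₁ , x₂ , x₃ in
      :dot3 L (t :· X) := t :* :dot3 L X)
    refl l₁ l₂ l₃ t x₁ x₂ x₃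

  dot3-comm : ∀ u v → dot3 u v ≈ dot3 v u
  dot3-comm (a , b , d) (x , y , z) = solve 6
    (λ a b d x y z → :dot3 (a , b , d) (x , y , z) := :dot3 (x , y , z) (a , b , d))
    refl a b d x y z

  dot3-zeroˡ : ∀ u → dot3 0ᵥ u ≈ 0#
  dot3-zeroˡ (a , b , d) = solve 3 (λ a b d → :dot3 (:0 , :0 , :0) (a , b , d) := :0) refl a b d

  dot3-zeroʳ : ∀ u → dot3 u 0ᵥ ≈ 0#
  dot3-zeroʳ u = trans (dot3-comm u 0ᵥ) (dot3-zeroˡ u)

  cross-zeroʳ : ∀ u → cross u 0ᵥ ≋ 0ᵥ
  cross-zeroʳ (a , b , d) = solve³ 3
    (λ a b d → :cross (a , b , d) (:0 , :0 , :0) :≋ (:0 , :0 , :0)) (refl , refl , refl) a b d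

  -- The solver's constant 1 evaluates to 1# + 0#, so identities involving 1# are proved for a
  -- variable o and instantiated at 1#.
  dot3-e₃ : ∀ a b d → dot3 e₃ (a , b , d) ≈ d
  dot3-e₃ a b d = begin
    dot3 e₃ (a , b , d) ≈⟨ solve 4 (λ o a b d → :dot3 (:0 , :0 , o) (a , b , d) := o :* d) refl 1# a b d ⟩
    1# * d              ≈⟨ *-identityˡ d ⟩
    d                   ∎
    where open ≈-Reasoning

  cross-· : ∀ s u t v → cross (s · u) (t · v) ≋ (s * t) · cross u v
  cross-· s (u₁ , u₂ , u₃) t (v₁ , v₂ , v₃) = solve³ 8
    (λ s u₁ u₂ u₃ t v₁ v₂ v₃ → let u = u₁ , u₂ , u₃ ; v = v₁ , v₂ , v₃ in
      :cross (s :· u) (t :· v) :≋ (s :* t) :· :cross u v)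
    (refl , refl , refl) s u₁ u₂ u₃ t v₁ v₂ v₃

  cross-·-self : ∀ t v → cross (t · v) v ≋ 0ᵥ
  cross-·-self t (v₁ , v₂ , v₃) = solve³ 4
    (λ t v₁ v₂ v₃ → let v = v₁ , v₂ , v₃ in :cross (t :· v) v :≋ (:0 , :0 , :0))
    (refl , refl , refl) t v₁ v₂ v₃

  dot3-crossˡ : ∀ u v → dot3 (cross u v) u ≈ 0#
  dot3-crossˡ (a , b , d) (x , y , z) = solve 6
    (λ a b d x y z → :dot3 (:cross (a , b , d) (x , y , z)) (a , b , d) := :0) refl a b d x y z

  dot3-crossʳ : ∀ u v → dot3 (cross u v) v ≈ 0#
  dot3-crossʳ (a , b , d) (x , y , z) = solve 6
    (λ a b d x y z → :dot3 (:cross (a , b , d) (x , y , z)) (x , y , z) := :0) refl a b d x y z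

  dot3-cross-⊕ : ∀ u v s t → dot3 (cross u v) (s · u ⊕ t · v) ≈ 0#
  dot3-cross-⊕ (u₁ , u₂ , u₃) (v₁ , v₂ , v₃) s t = solve 8
    (λ u₁ u₂ u₃ v₁ v₂ v₃ s t → let u = u₁ , u₂ , u₃ ; v = v₁ , v₂ , v₃ in
      :dot3 (:cross u v) (s :· u :⊕ t :· v) := :0)
    refl u₁ u₂ u₃ v₁ v₂ v₃ s t

  cross-cross : ∀ L u v → cross L (cross u v) ≋ dot3 L v · u ⊕ - dot3 L u · v
  cross-cross (l₁ , l₂ , l₃) (u₁ , u₂ , u₃) (v₁ , v₂ , v₃) = solve³ 9
    (λ l₁ l₂ l₃ u₁ u₂ u₃ v₁ v₂ v₃ → let L = l₁ , l₂ , l₃ ; u = u₁ , u₂ , u₃ ; v = v₁ , v₂ , v₃ in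
      :cross L (:cross u v) :≋ :dot3 L v :· u :⊕ :- :dot3 L u :· v)
    (refl , refl , refl) l₁ l₂ l₃ u₁ u₂ u₃ v₁ v₂ v₃

  cross-⊕ʳ : ∀ A s t B → cross A (s · A ⊕ t · B) ≋ t · cross A B
  cross-⊕ʳ (a₁ , a₂ , a₃) s t (b₁ , b₂ , b₃) = solve³ 8
    (λ a₁ a₂ a₃ s t b₁ b₂ b₃ → let A = a₁ , a₂ , a₃ ; B = b₁ , b₂ , b₃ in
      :cross A (s :· A :⊕ t :· B) :≋ t :· :cross A B)
    (refl , refl , refl) a₁ a₂ a₃ s t b₁ b₂ b₃

  cross-⊕ˡ : ∀ s A t B → cross (s · A ⊕ t · B) B ≋ s · cross A B
  cross-⊕ˡ s (a₁ , a₂ , a₃) t (b₁ , b₂ , b₃) = solve³ 8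
    (λ s a₁ a₂ a₃ t b₁ b₂ b₃ → let A = a₁ , a₂ , a₃ ; B = b₁ , b₂ , b₃ in
      :cross (s :· A :⊕ t :· B) B :≋ s :· :cross A B)
    (refl , refl , refl) s a₁ a₂ a₃ t b₁ b₂ b₃

  app3-⊕ : ∀ N s x t y → app3 N (s · x ⊕ t · y) ≋ s · app3 N x ⊕ t · app3 N y
  app3-⊕ ((m₁₁ , m₁₂ , m₁₃) , (m₂₁ , m₂₂ , m₂₃) , (m₃₁ , m₃₂ , m₃₃)) s (x₁ , x₂ , x₃) t (y₁ , y₂ , y₃) = solve³ 17
    (λ m₁₁ m₁₂ m₁₃ m₂₁ m₂₂ m₂₃ m₃₁ m₃₂ m₃₃ s x₁ x₂ x₃ t y₁ y₂ y₃ →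
      let N = (m₁₁ , m₁₂ , m₁₃) , (m₂₁ , m₂₂ , m₂₃) , (m₃₁ , m₃₂ , m₃₃) ; x = x₁ , x₂ , x₃ ; y = y₁ , y₂ , y₃ in
      :app3 N (s :· x :⊕ t :· y) :≋ s :· :app3 N x :⊕ t :· :app3 N y)
    (refl , refl , refl) m₁₁ m₁₂ m₁₃ m₂₁ m₂₂ m₂₃ m₃₁ m₃₂ m₃₃ s x₁ x₂ x₃ t y₁ y₂ y₃

  app3-zero : ∀ N → app3 N 0ᵥ ≋ 0ᵥ
  app3-zero (r₁ , r₂ , r₃) = dot3-zeroʳ r₁ , dot3-zeroʳ r₂ , dot3-zeroʳ r₃

  app3-· : ∀ N s x → app3 N (s · x) ≋ s · app3 N x
  app3-· ((m₁₁ , m₁₂ , m₁₃) , (m₂₁ , m₂₂ , m₂₃) , (m₃₁ , m₃₂ , m₃₃)) s (x₁ , x₂ , x₃) = solve³ 13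
    (λ m₁₁ m₁₂ m₁₃ m₂₁ m₂₂ m₂₃ m₃₁ m₃₂ m₃₃ s x₁ x₂ x₃ →
      let N = (m₁₁ , m₁₂ , m₁₃) , (m₂₁ , m₂₂ , m₂₃) , (m₃₁ , m₃₂ , m₃₃) ; x = x₁ , x₂ , x₃ in
      :app3 N (s :· x) :≋ s :· :app3 N x)
    (refl , refl , refl) m₁₁ m₁₂ m₁₃ m₂₁ m₂₂ m₂₃ m₃₁ m₃₂ m₃₃ s x₁ x₂ x₃

  det-app3 : ∀ N x y z → det (app3 N x) (app3 N y) (app3 N z) ≈ det3 N * det x y z
  det-app3 ((m₁₁ , m₁₂ , m₁₃) , (m₂₁ , m₂₂ , m₂₃) , (m₃₁ , m₃₂ , m₃₃)) (x₁ , x₂ , x₃) (y₁ , y₂ , y₃) (z₁ , z₂ , z₃) =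
    solve 18 (λ m₁₁ m₁₂ m₁₃ m₂₁ m₂₂ m₂₃ m₃₁ m₃₂ m₃₃ x₁ x₂ x₃ y₁ y₂ y₃ z₁ z₂ z₃ →
      let N = (m₁₁ , m₁₂ , m₁₃) , (m₂₁ , m₂₂ , m₂₃) , (m₃₁ , m₃₂ , m₃₃)
          x = x₁ , x₂ , x₃ ; y = y₁ , y₂ , y₃ ; z = z₁ , z₂ , z₃ in
      :det (:app3 N x) (:app3 N y) (:app3 N z) := :det3 N :* :det x y z)
    refl m₁₁ m₁₂ m₁₃ m₂₁ m₂₂ m₂₃ m₃₁ m₃₂ m₃₃ x₁ x₂ x₃ y₁ y₂ y₃ z₁ z₂ z₃

  dot3-project : ∀ r p u → dot3 r (project r p u) ≈ 0#
  dot3-project (r₁ , r₂ , r₃) (p₁ , p₂ , p₃) (u₁ , u₂ , u₃) = solve 9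
    (λ r₁ r₂ r₃ p₁ p₂ p₃ u₁ u₂ u₃ → let r = r₁ , r₂ , r₃ ; p = p₁ , p₂ , p₃ ; u = u₁ , u₂ , u₃ in
      :dot3 r (:project r p u) := :0)
    refl r₁ r₂ r₃ p₁ p₂ p₃ u₁ u₂ u₃

  project-⊕ : ∀ r p s a t b → project r p (s · a ⊕ t · b) ≋ s · project r p a ⊕ t · project r p b
  project-⊕ (r₁ , r₂ , r₃) (p₁ , p₂ , p₃) s (a₁ , a₂ , a₃) t (b₁ , b₂ , b₃) = solve³ 14
    (λ r₁ r₂ r₃ p₁ p₂ p₃ s a₁ a₂ a₃ t b₁ b₂ b₃ →
      let r = r₁ , r₂ , r₃ ; p = p₁ , p₂ , p₃ ; a = a₁ , a₂ , a₃ ; b = b₁ , b₂ , b₃ in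
      :project r p (s :· a :⊕ t :· b) :≋ s :· :project r p a :⊕ t :· :project r p b)
    (refl , refl , refl) r₁ r₂ r₃ p₁ p₂ p₃ s a₁ a₂ a₃ t b₁ b₂ b₃

  project-cramer : ∀ r p a b u →
    det a b p · project r p u ≋ det u b p · project r p a ⊕ det a u p · project r p b
  project-cramer (r₁ , r₂ , r₃) (p₁ , p₂ , p₃) (a₁ , a₂ , a₃) (b₁ , b₂ , b₃) (u₁ , u₂ , u₃) = solve³ 15
    (λ r₁ r₂ r₃ p₁ p₂ p₃ a₁ a₂ a₃ b₁ b₂ b₃ u₁ u₂ u₃ →
      let r = r₁ , r₂ , r₃ ; p = p₁ , p₂ , p₃ ; a = a₁ , a₂ , a₃ ; b = b₁ , b₂ , b₃ ; u = u₁ , u₂ , u₃ in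
      :det a b p :· :project r p u :≋ :det u b p :· :project r p a :⊕ :det a u p :· :project r p b)
    (refl , refl , refl) r₁ r₂ r₃ p₁ p₂ p₃ a₁ a₂ a₃ b₁ b₂ b₃ u₁ u₂ u₃

  det-project : ∀ r p a b → det (project r p a) (project r p b) p ≈ (dot3 r p * dot3 r p) * det a b p
  det-project (r₁ , r₂ , r₃) (p₁ , p₂ , p₃) (a₁ , a₂ , a₃) (b₁ , b₂ , b₃) = solve 12
    (λ r₁ r₂ r₃ p₁ p₂ p₃ a₁ a₂ a₃ b₁ b₂ b₃ →
      let r = r₁ , r₂ , r₃ ; p = p₁ , p₂ , p₃ ; a = a₁ , a₂ , a₃ ; b = b₁ , b₂ , b₃ in
      :det (:project r p a) (:project r p b) p := (:dot3 r p :* :dot3 r p) :* :det a b p)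
    refl r₁ r₂ r₃ p₁ p₂ p₃ a₁ a₂ a₃ b₁ b₂ b₃

  det-on-ℓ∞ : ∀ a₁ a₂ b₁ b₂ p₁ p₂ p₃ →
    det (a₁ , a₂ , 0#) (b₁ , b₂ , 0#) (p₁ , p₂ , p₃) ≈ det2 ((a₁ , b₁) , (a₂ , b₂)) * p₃
  det-on-ℓ∞ a₁ a₂ b₁ b₂ p₁ p₂ p₃ = solve 7
    (λ a₁ a₂ b₁ b₂ p₁ p₂ p₃ → :det (a₁ , a₂ , :0) (b₁ , b₂ , :0) (p₁ , p₂ , p₃) := :det2 ((a₁ , b₁) , (a₂ , b₂)) :* p₃)
    refl a₁ a₂ b₁ b₂ p₁ p₂ p₃

  ℓ∞-point-⊕ : ∀ N s a t b → ℓ∞-point N (s ·₂ a ⊕₂ t ·₂ b) ≋ s · ℓ∞-point N a ⊕ t · ℓ∞-point N b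
  ℓ∞-point-⊕ ((n₁₁ , n₁₂) , (n₂₁ , n₂₂)) s (a₁ , a₂) t (b₁ , b₂) = solve³ 10
    (λ n₁₁ n₁₂ n₂₁ n₂₂ s a₁ a₂ t b₁ b₂ → let N = (n₁₁ , n₁₂) , (n₂₁ , n₂₂) ; a = a₁ , a₂ ; b = b₁ , b₂ in
      :ℓ∞-point N (s :·₂ a :⊕₂ t :·₂ b) :≋ s :· :ℓ∞-point N a :⊕ t :· :ℓ∞-point N b)
    (refl , refl , refl) n₁₁ n₁₂ n₂₁ n₂₂ s a₁ a₂ t b₁ b₂

  ℓ∞-point-cramer : ∀ N a b c →
    cross₂ a b · ℓ∞-point N c ≋ cross₂ c b · ℓ∞-point N a ⊕ cross₂ a c · ℓ∞-point N b
  ℓ∞-point-cramer ((n₁₁ , n₁₂) , (n₂₁ , n₂₂)) (a₁ , a₂) (b₁ , b₂) (c₁ , c₂) = solve³ 10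
    (λ n₁₁ n₁₂ n₂₁ n₂₂ a₁ a₂ b₁ b₂ c₁ c₂ → let N = (n₁₁ , n₁₂) , (n₂₁ , n₂₂) ; a = a₁ , a₂ ; b = b₁ , b₂ ; c = c₁ , c₂ in
      :cross₂ a b :· :ℓ∞-point N c :≋ :cross₂ c b :· :ℓ∞-point N a :⊕ :cross₂ a c :· :ℓ∞-point N b)
    (refl , refl , refl) n₁₁ n₁₂ n₂₁ n₂₂ a₁ a₂ b₁ b₂ c₁ c₂

  cross-ℓ∞-point : ∀ N a b → cross (ℓ∞-point N a) (ℓ∞-point N b) ≋ (0# , 0# , det2 N * cross₂ a b)
  cross-ℓ∞-point ((n₁₁ , n₁₂) , (n₂₁ , n₂₂)) (a₁ , a₂) (b₁ , b₂) = solve³ 8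
    (λ n₁₁ n₁₂ n₂₁ n₂₂ a₁ a₂ b₁ b₂ → let N = (n₁₁ , n₁₂) , (n₂₁ , n₂₂) ; a = a₁ , a₂ ; b = b₁ , b₂ in
      :cross (:ℓ∞-point N a) (:ℓ∞-point N b) :≋ (:0 , :0 , :det2 N :* :cross₂ a b))
    (refl , refl , refl) n₁₁ n₁₂ n₂₁ n₂₂ a₁ a₂ b₁ b₂

  adj2-app2 : ∀ N w → adj2 N (app2 N w) ≋₂ det2 N ·₂ w
  adj2-app2 ((n₁₁ , n₁₂) , (n₂₁ , n₂₂)) (w₁ , w₂) =
    solve 6 (λ n₁₁ n₁₂ n₂₁ n₂₂ w₁ w₂ → let N = (n₁₁ , n₁₂) , (n₂₁ , n₂₂) in
      proj₁ (:adj2 N (:app2 N (w₁ , w₂))) := proj₁ (:det2 N :·₂ (w₁ , w₂))) refl n₁₁ n₁₂ n₂₁ n₂₂ w₁ w₂ ,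
    solve 6 (λ n₁₁ n₁₂ n₂₁ n₂₂ w₁ w₂ → let N = (n₁₁ , n₁₂) , (n₂₁ , n₂₂) in
      proj₂ (:adj2 N (:app2 N (w₁ , w₂))) := proj₂ (:det2 N :·₂ (w₁ , w₂))) refl n₁₁ n₁₂ n₂₁ n₂₂ w₁ w₂

  columns : V3 → V3 → Mat2
  columns (a₁ , a₂ , _) (b₁ , b₂ , _) = (a₁ , b₁) , (a₂ , b₂)

  ℓ∞-point-columns : ∀ {A B} s t → third A ≈ 0# → third B ≈ 0# →
    ℓ∞-point (columns A B) (s , t) ≋ s · A ⊕ t · B
  ℓ∞-point-columns {a₁ , a₂ , a₃} {b₁ , b₂ , b₃} s t a₃≈0 b₃≈0 =
    +-cong (*-comm a₁ s) (*-comm b₁ t) , +-cong (*-comm a₂ s) (*-comm b₂ t) , (begin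
      0#               ≈⟨ +-identityʳ 0# ⟨
      0# + 0#          ≈⟨ +-cong (zeroʳ s) (zeroʳ t) ⟨
      s * 0# + t * 0#  ≈⟨ +-cong (*-congˡ a₃≈0) (*-congˡ b₃≈0) ⟨
      s * a₃ + t * b₃  ∎)
    where open ≈-Reasoning

  ℓ∞-point-cong : ∀ N {w w'} → w ≋₂ w' → ℓ∞-point N w ≋ ℓ∞-point N w'
  ℓ∞-point-cong ((a , b) , (d , e)) (x , y) = +-cong (*-congˡ x) (*-congˡ y) , +-cong (*-congˡ x) (*-congˡ y) , refl

  ℓ∞-point-zero : ∀ N → ℓ∞-point N (0# , 0#) ≋ 0ᵥ
  ℓ∞-point-zero ((n₁₁ , n₁₂) , (n₂₁ , n₂₂)) = solve³ 4
    (λ n₁₁ n₁₂ n₂₁ n₂₂ → :ℓ∞-point ((n₁₁ , n₁₂) , (n₂₁ , n₂₂)) (:0 , :0) :≋ (:0 , :0 , :0))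
    (refl , refl , refl) n₁₁ n₁₂ n₂₁ n₂₂

  adj2-cong : ∀ N {w w'} → w ≋₂ w' → adj2 N w ≋₂ adj2 N w'
  adj2-cong ((a , b) , (d , e)) (x , y) = +-cong (*-congˡ x) (-‿cong (*-congˡ y)) , +-cong (*-congˡ y) (-‿cong (*-congˡ x))

  adj2-zero : ∀ N → adj2 N (0# , 0#) ≋₂ (0# , 0#)
  adj2-zero ((n₁₁ , n₁₂) , (n₂₁ , n₂₂)) =
    solve 4 (λ n₁₁ n₁₂ n₂₁ n₂₂ → proj₁ (:adj2 ((n₁₁ , n₁₂) , (n₂₁ , n₂₂)) (:0 , :0)) := :0) refl n₁₁ n₁₂ n₂₁ n₂₂ ,
    solve 4 (λ n₁₁ n₁₂ n₂₁ n₂₂ → proj₂ (:adj2 ((n₁₁ , n₁₂) , (n₂₁ , n₂₂)) (:0 , :0)) := :0) refl n₁₁ n₁₂ n₂₁ n₂₂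

  det-e₂e₃ : ∀ o p₁ p₂ p₃ → det (0# , o , 0#) (0# , 0# , o) (p₁ , p₂ , p₃) ≈ (o * o) * p₁
  det-e₂e₃ o p₁ p₂ p₃ =
    solve 4 (λ o p₁ p₂ p₃ → :det (:0 , o , :0) (:0 , :0 , o) (p₁ , p₂ , p₃) := (o :* o) :* p₁) refl o p₁ p₂ p₃

  det-e₁e₃ : ∀ o p₁ p₂ p₃ → det (o , 0# , 0#) (0# , 0# , o) (p₁ , p₂ , p₃) ≈ - ((o * o) * p₂)
  det-e₁e₃ o p₁ p₂ p₃ =
    solve 4 (λ o p₁ p₂ p₃ → :det (o , :0 , :0) (:0 , :0 , o) (p₁ , p₂ , p₃) := :- ((o :* o) :* p₂)) refl o p₁ p₂ p₃

  det-e₁e₂ : ∀ o p₁ p₂ p₃ → det (o , 0# , 0#) (0# , o , 0#) (p₁ , p₂ , p₃) ≈ (o * o) * p₃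
  det-e₁e₂ o p₁ p₂ p₃ =
    solve 4 (λ o p₁ p₂ p₃ → :det (o , :0 , :0) (:0 , o , :0) (p₁ , p₂ , p₃) := (o :* o) :* p₃) refl o p₁ p₂ p₃

  ⊕-rescale : ∀ {A B A' B' α β} x y → A' ≋ α · A → B' ≋ β · B →
    x · A' ⊕ y · B' ≋ (x * α) · A ⊕ (y * β) · B
  ⊕-rescale {A} {B} {α = α} {β} x y A'≋αA B'≋βB =
    ⊕-cong (≋-trans (·-cong refl A'≋αA) (·-assoc x α A)) (≋-trans (·-cong refl B'≋βB) (·-assoc y β B))

  -- Given the relations of frame-ratios, the point s A + t B is, up to the factor d' γ x y, the
  -- point with coordinates (s x' y , t y' x) with respect to the frame (A' , B').
  frame-transfer : ∀ {A B A' B' W d x y d' x' y' α β γ s t} →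
    d * (x' * α) ≈ (d' * γ) * x → d * (y' * β) ≈ (d' * γ) * y →
    A' ≋ α · A → B' ≋ β · B → d · W ≋ s · A ⊕ t · B →
    d · ((s * x' * y) · A' ⊕ (t * y' * x) · B') ≋ d · (((d' * γ) * x * y) · W)
  frame-transfer {A} {B} {A'} {B'} {W} {d} {x} {y} {d'} {x'} {y'} {α} {β} {γ} {s} {t} ratio-A ratio-B A'≋ B'≋ dW =
    begin
      d · ((s * x' * y) · A' ⊕ (t * y' * x) · B')                  ≈⟨ ·-cong refl (⊕-rescale _ _ A'≋ B'≋) ⟩
      d · (((s * x' * y) * α) · A ⊕ ((t * y' * x) * β) · B)        ≈⟨ ·-distrib-⊕ d _ A _ B ⟩
      (d * ((s * x' * y) * α)) · A ⊕ (d * ((t * y' * x) * β)) · B  ≈⟨ ⊕-cong (·-cong coefficient-A ≋-refl)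
                                                                             (·-cong coefficient-B ≋-refl) ⟩
      (κ * s) · A ⊕ (κ * t) · B                                    ≈⟨ ·-distrib-⊕ κ s A t B ⟨
      κ · (s · A ⊕ t · B)                                          ≈⟨ ·-cong refl dW ⟨
      κ · (d · W)                                                  ≈⟨ ·-comm κ d W ⟩
      d · (κ · W)                                                  ∎
    where
    open ≋-Reasoning
    κ = (d' * γ) * x * y
    shuffle : ∀ d s x' y α → d * ((s * x' * y) * α) ≈ (s * y) * (d * (x' * α))
    shuffle = solve 5 (λ d s x' y α → d :* ((s :* x' :* y) :* α) := (s :* y) :* (d :* (x' :* α))) refl
    coefficient-A : d * ((s * x' * y) * α) ≈ κ * s
    coefficient-A = trans (shuffle d s x' y α) (trans (*-congˡ ratio-A)
      (solve 5 (λ s y e γ x → (s :* y) :* ((e :* γ) :* x) := (e :* γ :* x :* y) :* s) refl s y d' γ x))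
    coefficient-B : d * ((t * y' * x) * β) ≈ κ * t
    coefficient-B = trans (shuffle d t y' x β) (trans (*-congˡ ratio-B)
      (solve 5 (λ t x e γ y → (t :* x) :* ((e :* γ) :* y) := (e :* γ :* x :* y) :* t) refl t x d' γ y))

module ProjectivePlane {c ℓ : Level} (R : CommutativeRing c ℓ) (isField : Geometry.IsField R)
  (_≟_ : Decidable (CommutativeRing._≈_ R)) where

  open CommutativeRing R hiding (zero)
  open Geometry R
  open IntegerSolver R using (solve; _:=_; _:-_; _:*_)
  open Coordinates R
  open import Algebra.Properties.Group +-group using (x∙y⁻¹≈ε⇒x≈y; x≈y⇒x∙y⁻¹≈ε; ε⁻¹≈ε)
  open import Algebra.Properties.Ring ring using (-‿involutive)

  1≉0 : 1# ≉ 0#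
  1≉0 = proj₁ isField

  _⁻¹ : ∀ x → x ≉ 0# → Carrier
  (x ⁻¹) x≉0 = proj₁ (proj₂ isField x x≉0)

  *-inverseʳ : ∀ x (x≉0 : x ≉ 0#) → x * (x ⁻¹) x≉0 ≈ 1#
  *-inverseʳ x x≉0 = proj₂ (proj₂ isField x x≉0)

  *-inverseˡ : ∀ x (x≉0 : x ≉ 0#) → (x ⁻¹) x≉0 * x ≈ 1#
  *-inverseˡ x x≉0 = trans (*-comm _ x) (*-inverseʳ x x≉0)

  x*y≈0⇒y≈0 : ∀ {x y} → x ≉ 0# → x * y ≈ 0# → y ≈ 0#
  x*y≈0⇒y≈0 {x} {y} x≉0 xy≈0 = begin
    y                ≈⟨ *-identityˡ y ⟨
    1# * y           ≈⟨ *-congʳ (*-inverseˡ x x≉0) ⟨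
    (x⁻¹ * x) * y    ≈⟨ *-assoc x⁻¹ x y ⟩
    x⁻¹ * (x * y)    ≈⟨ *-congˡ xy≈0 ⟩
    x⁻¹ * 0#         ≈⟨ zeroʳ x⁻¹ ⟩
    0#               ∎
    where
    open ≈-Reasoning
    x⁻¹ = (x ⁻¹) x≉0

  *-nonzero : ∀ {x y} → x ≉ 0# → y ≉ 0# → x * y ≉ 0#
  *-nonzero x≉0 y≉0 xy≈0 = y≉0 (x*y≈0⇒y≈0 x≉0 xy≈0)

  -‿nonzero : ∀ {x} → x ≉ 0# → - x ≉ 0#
  -‿nonzero {x} x≉0 -x≈0 = x≉0 (trans (sym (-‿involutive x)) (trans (-‿cong -x≈0) ε⁻¹≈ε))

  ⁻¹-nonzero : ∀ x (x≉0 : x ≉ 0#) → (x ⁻¹) x≉0 ≉ 0#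
  ⁻¹-nonzero x x≉0 x⁻¹≈0 = 1≉0 (begin
    1#              ≈⟨ *-inverseʳ x x≉0 ⟨
    x * (x ⁻¹) x≉0  ≈⟨ *-congˡ x⁻¹≈0 ⟩
    x * 0#          ≈⟨ zeroʳ x ⟩
    0#              ∎)
    where open ≈-Reasoning

  *-cancelʳ : ∀ {x y c} → c ≉ 0# → x * c ≈ y * c → x ≈ y
  *-cancelʳ {x} {y} {c} c≉0 xc≈yc = x∙y⁻¹≈ε⇒x≈y x y (x*y≈0⇒y≈0 c≉0 (begin
    c * (x - y)      ≈⟨ solve 3 (λ c x y → c :* (x :- y) := x :* c :- y :* c) refl c x y ⟩
    x * c - y * c    ≈⟨ x≈y⇒x∙y⁻¹≈ε xc≈yc ⟩
    0#               ∎))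
    where open ≈-Reasoning

  ·-cancelˡ : ∀ {t u v} → t ≉ 0# → t · u ≋ t · v → u ≋ v
  ·-cancelˡ {t} t≉0 (x , y , z) = cancel x , cancel y , cancel z
    where
    cancel : ∀ {a b} → t * a ≈ t * b → a ≈ b
    cancel e = *-cancelʳ t≉0 (trans (*-comm _ t) (trans e (*-comm t _)))

  ·-zero⇒zero : ∀ {t u} → t ≉ 0# → t · u ≋ 0ᵥ → u ≋ 0ᵥ
  ·-zero⇒zero t≉0 e = ·-cancelˡ t≉0 (≋-trans e (≋-sym (·-zeroʳ _)))

  ∼-refl : ∀ {u} → u ∼ u
  ∼-refl {u} = 1# , 1≉0 , ≋-sym (·-identityˡ u)

  ≋⇒∼ : ∀ {u v} → u ≋ v → u ∼ v
  ≋⇒∼ {u} {v} u≋v = 1# , 1≉0 , ≋-trans u≋v (≋-sym (·-identityˡ v))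

  ·-∼ : ∀ {t} u → t ≉ 0# → (t · u) ∼ u
  ·-∼ {t} u t≉0 = t , t≉0 , ≋-refl

  ∼-sym : ∀ {u v} → u ∼ v → v ∼ u
  ∼-sym {u} {v} (t , t≉0 , u≋tv) = t⁻¹ , ⁻¹-nonzero t t≉0 , (begin
    v               ≈⟨ ·-identityˡ v ⟨
    1# · v          ≈⟨ ·-cong (*-inverseˡ t t≉0) ≋-refl ⟨
    (t⁻¹ * t) · v   ≈⟨ ·-assoc t⁻¹ t v ⟨
    t⁻¹ · (t · v)   ≈⟨ ·-cong refl u≋tv ⟨
    t⁻¹ · u         ∎)
    where
    open ≋-Reasoning
    t⁻¹ = (t ⁻¹) t≉0

  ∼-trans : ∀ {u v w} → u ∼ v → v ∼ w → u ∼ w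
  ∼-trans {u} {v} {w} (s , s≉0 , u≋sv) (t , t≉0 , v≋tw) =
    s * t , *-nonzero s≉0 t≉0 , ≋-trans u≋sv (≋-trans (·-cong refl v≋tw) (·-assoc s t w))

  ∼-≋ : ∀ {u v w} → u ∼ v → v ≋ w → u ∼ w
  ∼-≋ u∼v v≋w = ∼-trans u∼v (≋⇒∼ v≋w)

  nonzero-∼ : ∀ {u v} → NonZero3 u → u ∼ v → NonZero3 v
  nonzero-∼ {v = v} u≉0 (t , _ , u≋tv) v≋0 = u≉0 (≋-trans u≋tv (≋-trans (·-cong refl v≋0) (·-zeroʳ t)))

  incident-∼ʳ : ∀ {L X Y} → Incident L X → Y ∼ X → Incident L Y
  incident-∼ʳ {L} {X} (LX≈0) (t , _ , Y≋tX) = begin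
    dot3 L _        ≈⟨ dot3-cong ≋-refl Y≋tX ⟩
    dot3 L (t · X)  ≈⟨ dot3-·ʳ L t X ⟩
    t * dot3 L X    ≈⟨ *-congˡ LX≈0 ⟩
    t * 0#          ≈⟨ zeroʳ t ⟩
    0#              ∎
    where open ≈-Reasoning

  incident-∼ˡ : ∀ {L L' X} → Incident L X → L' ∼ L → Incident L' X
  incident-∼ˡ {L} {L'} {X} LX≈0 L'∼L =
    trans (dot3-comm L' X) (incident-∼ʳ {X} {L} {L'} (trans (dot3-comm X L) LX≈0) L'∼L)

  incident-≋ : ∀ {L X Y} → Incident L X → Y ≋ X → Incident L Y
  incident-≋ LX≈0 Y≋X = incident-∼ʳ LX≈0 (≋⇒∼ Y≋X)

  cross-∼ : ∀ {u u' v v'} → u ∼ u' → v ∼ v' → cross u v ∼ cross u' v'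
  cross-∼ {u' = u'} {v' = v'} (s , s≉0 , u≋su') (t , t≉0 , v≋tv') =
    s * t , *-nonzero s≉0 t≉0 , ≋-trans (cross-cong u≋su' v≋tv') (cross-· s u' t v')

  ∼⇒cross≋0 : ∀ {u v} → u ∼ v → cross u v ≋ 0ᵥ
  ∼⇒cross≋0 {v = v} (t , _ , u≋tv) = ≋-trans (cross-cong u≋tv ≋-refl) (cross-·-self t v)

  private
    rotate : V3 → V3
    rotate (a , b , d) = b , d , a

    rotate-∼ : ∀ {u v} → rotate u ∼ rotate v → u ∼ v
    rotate-∼ (t , t≉0 , a , b , d) = t , t≉0 , d , a , b

    rotate-nonzero : ∀ {u} → NonZero3 u → NonZero3 (rotate u)
    rotate-nonzero u≉0 (a , b , d) = u≉0 (d , a , b)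

    rotate-cross≋0 : ∀ {u v} → cross u v ≋ 0ᵥ → cross (rotate u) (rotate v) ≋ 0ᵥ
    rotate-cross≋0 (a , b , d) = b , d , a

    -- with v₁ invertible, u = (u₁ / v₁) · v
    cross≋0⇒∼-pivot : ∀ u v → proj₁ v ≉ 0# → NonZero3 u → cross u v ≋ 0ᵥ → u ∼ v
    cross≋0⇒∼-pivot (u₁ , u₂ , u₃) (v₁ , v₂ , v₃) v₁≉0 u≉0 (_ , e₂ , e₃) =
      t , t≉0 , ratio refl , ratio (sym (x∙y⁻¹≈ε⇒x≈y _ _ e₃)) , ratio (x∙y⁻¹≈ε⇒x≈y _ _ e₂)
      where
      w = (v₁ ⁻¹) v₁≉0
      t = u₁ * w
      ratio : ∀ {a b} → a * v₁ ≈ u₁ * b → a ≈ t * b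
      ratio {a} {b} av₁≈u₁b = begin
        a                 ≈⟨ *-identityʳ a ⟨
        a * 1#            ≈⟨ *-congˡ (*-inverseʳ v₁ v₁≉0) ⟨
        a * (v₁ * w)      ≈⟨ *-assoc a v₁ w ⟨
        (a * v₁) * w      ≈⟨ *-congʳ av₁≈u₁b ⟩
        (u₁ * b) * w      ≈⟨ solve 3 (λ u₁ b w → (u₁ :* b) :* w := (u₁ :* w) :* b) refl u₁ b w ⟩
        t * b             ∎
        where open ≈-Reasoning
      t≉0 : t ≉ 0#
      t≉0 t≈0 = u≉0 (zero-if (ratio refl) , zero-if (ratio (sym (x∙y⁻¹≈ε⇒x≈y _ _ e₃))) ,
                     zero-if (ratio (x∙y⁻¹≈ε⇒x≈y _ _ e₂)))
        where
        zero-if : ∀ {a b} → a ≈ t * b → a ≈ 0#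
        zero-if a≈tb = trans a≈tb (trans (*-congʳ t≈0) (zeroˡ _))

  cross≋0⇒∼ : ∀ {u v} → NonZero3 u → NonZero3 v → cross u v ≋ 0ᵥ → u ∼ v
  cross≋0⇒∼ {u} {v} u≉0 v≉0 uv≋0 with proj₁ v ≟ 0#
  ... | no v₁≉0 = cross≋0⇒∼-pivot u v v₁≉0 u≉0 uv≋0
  ... | yes v₁≈0 with proj₁ (rotate v) ≟ 0#
  ...   | no v₂≉0 = rotate-∼ (cross≋0⇒∼-pivot (rotate u) (rotate v) v₂≉0 (rotate-nonzero u≉0) (rotate-cross≋0 uv≋0))
  ...   | yes v₂≈0 with proj₁ (rotate (rotate v)) ≟ 0#
  ...     | no v₃≉0 = rotate-∼ (rotate-∼ (cross≋0⇒∼-pivot (rotate (rotate u)) (rotate (rotate v)) v₃≉0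
                        (rotate-nonzero (rotate-nonzero u≉0)) (rotate-cross≋0 (rotate-cross≋0 uv≋0))))
  ...     | yes v₃≈0 = ⊥-elim (v≉0 (v₁≈0 , v₂≈0 , v₃≈0))

  _≋0? : ∀ u → Dec (u ≋ 0ᵥ)
  (a , b , d) ≋0? with a ≟ 0# | b ≟ 0# | d ≟ 0#
  ... | yes a≈0 | yes b≈0 | yes d≈0 = yes (a≈0 , b≈0 , d≈0)
  ... | no a≉0  | _       | _       = no λ (a≈0 , _) → a≉0 a≈0
  ... | _       | no b≉0  | _       = no λ (_ , b≈0 , _) → b≉0 b≈0
  ... | _       | _       | no d≉0  = no λ (_ , _ , d≈0) → d≉0 d≈0

  ∼? : ∀ {u v} → NonZero3 u → NonZero3 v → Dec (u ∼ v)
  ∼? {u} {v} u≉0 v≉0 with cross u v ≋0?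
  ... | yes uv≋0 = yes (cross≋0⇒∼ u≉0 v≉0 uv≋0)
  ... | no uv≉0  = no λ u∼v → uv≉0 (∼⇒cross≋0 u∼v)

  cross-nonzero : ∀ {u v} → NonZero3 u → NonZero3 v → ¬ u ∼ v → NonZero3 (cross u v)
  cross-nonzero u≉0 v≉0 u≁v uv≋0 = u≁v (cross≋0⇒∼ u≉0 v≉0 uv≋0)

  line-through : ∀ {L u v} → NonZero3 u → NonZero3 v → ¬ u ∼ v → NonZero3 L →
    Incident L u → Incident L v → L ∼ cross u v
  line-through {L} {u} {v} u≉0 v≉0 u≁v L≉0 Lu≈0 Lv≈0 =
    cross≋0⇒∼ L≉0 (cross-nonzero u≉0 v≉0 u≁v) (begin
      cross L (cross u v)              ≈⟨ cross-cross L u v ⟩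
      dot3 L v · u ⊕ - dot3 L u · v    ≈⟨ ⊕-cong (·-cong Lv≈0 ≋-refl) (·-cong (-‿cong Lu≈0) ≋-refl) ⟩
      0# · u ⊕ - 0# · v                ≈⟨ ⊕-cong ≋-refl (·-cong ε⁻¹≈ε ≋-refl) ⟩
      0# · u ⊕ 0# · v                  ≈⟨ ·-⊕-zero u v ⟩
      0ᵥ                               ∎)
    where open ≋-Reasoning

  meet-point : ∀ {L L' X} → NonZero3 L → NonZero3 L' → ¬ L ∼ L' → NonZero3 X →
    Incident L X → Incident L' X → X ∼ cross L L'
  meet-point {L} {L'} {X} L≉0 L'≉0 L≁L' X≉0 LX≈0 L'X≈0 =
    line-through L≉0 L'≉0 L≁L' X≉0 (trans (dot3-comm X L) LX≈0) (trans (dot3-comm X L') L'X≈0)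

  third≈0-∼ : ∀ {X Y} → X ∼ Y → third Y ≈ 0# → third X ≈ 0#
  third≈0-∼ (λ' , _ , _ , _ , X₃≈λ'Y₃) Y₃≈0 = trans X₃≈λ'Y₃ (trans (*-congˡ Y₃≈0) (zeroʳ λ'))

  e₃≉0 : NonZero3 e₃
  e₃≉0 (_ , _ , 1≈0) = 1≉0 1≈0

  OnInf⇒incident-e₃ : ∀ {X} → OnInf X → Incident e₃ X
  OnInf⇒incident-e₃ {a , b , d} (_ , d≈0) = trans (dot3-e₃ a b d) d≈0

  incident-e₃⇒OnInf : ∀ {X} → NonZero3 X → Incident e₃ X → OnInf X
  incident-e₃⇒OnInf {a , b , d} X≉0 e₃X≈0 = X≉0 , trans (sym (dot3-e₃ a b d)) e₃X≈0

  basis : Fin 3 → V3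
  basis zero             = 1# , 0# , 0#
  basis (suc zero)       = 0# , 1# , 0#
  basis (suc (suc zero)) = 0# , 0# , 1#

  1*1≉0 : 1# * 1# ≉ 0#
  1*1≉0 = *-nonzero 1≉0 1≉0

  complement : ∀ {p} → NonZero3 p → ∃₂ λ i j → det (basis i) (basis j) p ≉ 0#
  complement {p₁ , p₂ , p₃} p≉0 with p₁ ≟ 0# | p₂ ≟ 0# | p₃ ≟ 0#
  ... | no p₁≉0 | _ | _ = suc zero , suc (suc zero) , λ d≈0 →
    *-nonzero 1*1≉0 p₁≉0 (trans (sym (det-e₂e₃ 1# p₁ p₂ p₃)) d≈0)
  ... | _ | no p₂≉0 | _ = zero , suc (suc zero) , λ d≈0 →
    -‿nonzero (*-nonzero 1*1≉0 p₂≉0) (trans (sym (det-e₁e₃ 1# p₁ p₂ p₃)) d≈0)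
  ... | _ | _ | no p₃≉0 = zero , suc zero , λ d≈0 →
    *-nonzero 1*1≉0 p₃≉0 (trans (sym (det-e₁e₂ 1# p₁ p₂ p₃)) d≈0)
  ... | yes p₁≈0 | yes p₂≈0 | yes p₃≈0 = ⊥-elim (p≉0 (p₁≈0 , p₂≈0 , p₃≈0))

  app3-nonzero : ∀ {N v} → Invertible3 N → NonZero3 v → NonZero3 (app3 N v)
  app3-nonzero {N} {v} N-inv v≉0 Nv≋0 = *-nonzero N-inv det≉0 (begin
    det3 N * det a b v                     ≈⟨ det-app3 N a b v ⟨
    det (app3 N a) (app3 N b) (app3 N v)   ≈⟨ dot3-cong ≋-refl Nv≋0 ⟩
    dot3 (cross (app3 N a) (app3 N b)) 0ᵥ  ≈⟨ dot3-zeroʳ _ ⟩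
    0#                                     ∎)
    where
    open ≈-Reasoning
    a = basis (proj₁ (complement v≉0))
    b = basis (proj₁ (proj₂ (complement v≉0)))
    det≉0 = proj₂ (proj₂ (complement v≉0))

  coefficients-unique : ∀ {A B s₁ t₁ s₂ t₂} → third (cross A B) ≉ 0# →
    s₁ · A ⊕ t₁ · B ≋ s₂ · A ⊕ t₂ · B → s₁ ≈ s₂ × t₁ ≈ t₂
  coefficients-unique {A} {B} {s₁} {t₁} {s₂} {t₂} c≉0 e =
    *-cancelʳ c≉0 (proj₂ (proj₂ (begin
      s₁ · cross A B               ≈⟨ cross-⊕ˡ s₁ A t₁ B ⟨
      cross (s₁ · A ⊕ t₁ · B) B    ≈⟨ cross-cong e ≋-refl ⟩
      cross (s₂ · A ⊕ t₂ · B) B    ≈⟨ cross-⊕ˡ s₂ A t₂ B ⟩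
      s₂ · cross A B               ∎))) ,
    *-cancelʳ c≉0 (proj₂ (proj₂ (begin
      t₁ · cross A B               ≈⟨ cross-⊕ʳ A s₁ t₁ B ⟨
      cross A (s₁ · A ⊕ t₁ · B)    ≈⟨ cross-cong ≋-refl e ⟩
      cross A (s₂ · A ⊕ t₂ · B)    ≈⟨ cross-⊕ʳ A s₂ t₂ B ⟩
      t₂ · cross A B               ∎)))
    where open ≋-Reasoning

  ℓ∞-point-nonzero : ∀ {N w} → Invertible2 N → NonZero2 w → NonZero3 (ℓ∞-point N w)
  ℓ∞-point-nonzero {N} {w} N-inv w≉0 (x≈0 , y≈0 , _) =
    w≉0 (x*y≈0⇒y≈0 N-inv (trans (sym (proj₁ Dw≋0)) (proj₁ (adj2-zero N))) ,
         x*y≈0⇒y≈0 N-inv (trans (sym (proj₂ Dw≋0)) (proj₂ (adj2-zero N))))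
    where
    Dw≋0 : adj2 N (0# , 0#) ≋₂ det2 N ·₂ w
    Dw≋0 = let e = adj2-cong N (x≈0 , y≈0) ; f = adj2-app2 N w in
      trans (sym (proj₁ e)) (proj₁ f) , trans (sym (proj₂ e)) (proj₂ f)

  ℓ∞-point-∼⇒cross₂≈0 : ∀ {N u v} → Invertible2 N → ℓ∞-point N u ∼ ℓ∞-point N v → cross₂ u v ≈ 0#
  ℓ∞-point-∼⇒cross₂≈0 {N} {u} {v} N-inv Nu∼Nv =
    x*y≈0⇒y≈0 N-inv (trans (sym (proj₂ (proj₂ (cross-ℓ∞-point N u v)))) (proj₂ (proj₂ (∼⇒cross≋0 Nu∼Nv))))

  cross₂≈0⇒ℓ∞-point-∼ : ∀ {N u v} → Invertible2 N → NonZero2 u → NonZero2 v →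
    cross₂ u v ≈ 0# → ℓ∞-point N u ∼ ℓ∞-point N v
  cross₂≈0⇒ℓ∞-point-∼ {N} {u} {v} N-inv u≉0 v≉0 uv≈0 =
    cross≋0⇒∼ (ℓ∞-point-nonzero N-inv u≉0) (ℓ∞-point-nonzero N-inv v≉0)
      (≋-trans (cross-ℓ∞-point N u v) (refl , refl , trans (*-congˡ uv≈0) (zeroʳ _)))

  cross₂-nonzero : ∀ {N u v P Q} → Invertible2 N → NonZero2 u → NonZero2 v →
    P ∼ ℓ∞-point N u → Q ∼ ℓ∞-point N v → ¬ P ∼ Q → cross₂ u v ≉ 0#
  cross₂-nonzero N-inv u≉0 v≉0 P∼Nu Q∼Nv P≁Q uv≈0 =
    P≁Q (∼-trans P∼Nu (∼-trans (cross₂≈0⇒ℓ∞-point-∼ N-inv u≉0 v≉0 uv≈0) (∼-sym Q∼Nv)))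

  -- Compares the coordinates of C with respect to (A , B) obtained from the two frames; for the
  -- frames of two sublines it shows that α / γ = d' x / (d x') and β / γ = d' y / (d y') lie in K.
  frame-ratios : ∀ {A B C A' B' C' d x y d' x' y' α β γ} → third (cross A B) ≉ 0# →
    d · C ≋ x · A ⊕ y · B → d' · C' ≋ x' · A' ⊕ y' · B' →
    A' ≋ α · A → B' ≋ β · B → C' ≋ γ · C →
    d * (x' * α) ≈ (d' * γ) * x × d * (y' * β) ≈ (d' * γ) * y
  frame-ratios {A} {B} {C} {A'} {B'} {C'} {d} {x} {y} {d'} {x'} {y'} {α} {β} {γ} AB≉0 dC dC' A'≋ B'≋ C'≋ =
    coefficients-unique AB≉0 (begin
      (d * (x' * α)) · A ⊕ (d * (y' * β)) · B   ≈⟨ ·-distrib-⊕ d (x' * α) A (y' * β) B ⟨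
      d · ((x' * α) · A ⊕ (y' * β) · B)          ≈⟨ ·-cong refl (⊕-rescale x' y' A'≋ B'≋) ⟨
      d · (x' · A' ⊕ y' · B')                    ≈⟨ ·-cong refl dC' ⟨
      d · (d' · C')                              ≈⟨ ·-cong refl (≋-trans (·-cong refl C'≋) (·-assoc d' γ C)) ⟩
      d · ((d' * γ) · C)                         ≈⟨ ·-comm d (d' * γ) C ⟩
      (d' * γ) · (d · C)                         ≈⟨ ·-cong refl dC ⟩
      (d' * γ) · (x · A ⊕ y · B)                 ≈⟨ ·-distrib-⊕ (d' * γ) x A y B ⟩
      ((d' * γ) * x) · A ⊕ ((d' * γ) * y) · B    ∎)
    where open ≋-Reasoning

module Subgeometry {c ℓ k : Level} (R : CommutativeRing c ℓ) (isField : Geometry.IsField R)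
  (_≟_ : Decidable (CommutativeRing._≈_ R))
  (K : CommutativeRing.Carrier R → Set k) (isSubfield : Geometry.IsSubfield R K) where

  open CommutativeRing R hiding (zero)
  open Geometry R
  open Sub K
  open IntegerSolver R using (solve; _:=_; _:*_; :-_)
  open Coordinates R
  open ProjectivePlane R isField _≟_

  K-0 : K 0#
  K-0 = proj₁ (proj₂ isSubfield)

  K-1 : K 1#
  K-1 = proj₁ (proj₂ (proj₂ isSubfield))

  K-+ : ∀ {x y} → K x → K y → K (x + y)
  K-+ = proj₁ (proj₂ (proj₂ (proj₂ isSubfield))) _ _

  K-‿ : ∀ {x} → K x → K (- x)
  K-‿ = proj₁ (proj₂ (proj₂ (proj₂ (proj₂ isSubfield)))) _

  K-* : ∀ {x y} → K x → K y → K (x * y)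
  K-* = proj₁ (proj₂ (proj₂ (proj₂ (proj₂ (proj₂ isSubfield))))) _ _

  K-dot3 : ∀ {u v} → InK3 u → InK3 v → K (dot3 u v)
  K-dot3 (a , b , d) (x , y , z) = K-+ (K-+ (K-* a x) (K-* b y)) (K-* d z)

  K-cross : ∀ {u v} → InK3 u → InK3 v → InK3 (cross u v)
  K-cross (a , b , d) (x , y , z) =
    K-+ (K-* b z) (K-‿ (K-* d y)) , K-+ (K-* d x) (K-‿ (K-* a z)) , K-+ (K-* a y) (K-‿ (K-* b x))

  K-det : ∀ {u v w} → InK3 u → InK3 v → InK3 w → K (det u v w)
  K-det Ku Kv Kw = K-dot3 (K-cross Ku Kv) Kw

  K-·-⊕ : ∀ {s u t v} → K s → InK3 u → K t → InK3 v → InK3 (s · u ⊕ t · v)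
  K-·-⊕ Ks (a , b , d) Kt (x , y , z) = K-+ (K-* Ks a) (K-* Kt x) , K-+ (K-* Ks b) (K-* Kt y) , K-+ (K-* Ks d) (K-* Kt z)

  K-cross₂ : ∀ {u v} → InK2 u → InK2 v → K (cross₂ u v)
  K-cross₂ (a₁ , a₂) (b₁ , b₂) = K-+ (K-* a₁ b₂) (K-‿ (K-* a₂ b₁))

  K-·₂-⊕₂ : ∀ {s u t v} → K s → InK2 u → K t → InK2 v → InK2 (s ·₂ u ⊕₂ t ·₂ v)
  K-·₂-⊕₂ Ks (a₁ , a₂) Kt (b₁ , b₂) = K-+ (K-* Ks a₁) (K-* Kt b₁) , K-+ (K-* Ks a₂) (K-* Kt b₂)

  K-basis : ∀ i → InK3 (basis i)
  K-basis zero             = K-1 , K-0 , K-0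
  K-basis (suc zero)       = K-0 , K-1 , K-0
  K-basis (suc (suc zero)) = K-0 , K-0 , K-1

  Distinct3 : V3 → V3 → V3 → Set (c ⊔ ℓ)
  Distinct3 T U V = ¬ T ∼ U × ¬ T ∼ V × ¬ U ∼ V

  OnSubline3 : Mat2 → V3 → V3 → V3 → Set (c ⊔ ℓ ⊔ k)
  OnSubline3 N T U V = OnSubline N T × OnSubline N U × OnSubline N V

  OnSubline-ℓ∞-point : ∀ {N w} → Invertible2 N → InK2 w → NonZero2 w → OnSubline N (ℓ∞-point N w)
  OnSubline-ℓ∞-point N-inv Kw w≉0 = ℓ∞-point-nonzero N-inv w≉0 , _ , Kw , w≉0 , ∼-refl

  OnSubline⇒OnInf : ∀ {N X} → OnSubline N X → OnInf X
  OnSubline⇒OnInf (X≉0 , _ , _ , _ , X∼Nw) = X≉0 , third≈0-∼ X∼Nw refl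

  subline-⊆ : ∀ {N N' T U V} → Invertible2 N → Invertible2 N' → Distinct3 T U V →
    OnSubline3 N T U V → OnSubline3 N' T U V → Subset (OnSubline N) (OnSubline N')
  subline-⊆ {N} {N'} N-inv N'-inv (T≁U , T≁V , U≁V)
    ((_ , a , Ka , a≉0 , T∼A) , (_ , b , Kb , b≉0 , U∼B) , (_ , c , Kc , c≉0 , V∼C))
    ((_ , a' , Ka' , a'≉0 , T∼A') , (_ , b' , Kb' , b'≉0 , U∼B') , (_ , c' , Kc' , c'≉0 , V∼C'))
    Q (Q≉0 , w , Kw , w≉0 , Q∼W) = Q≉0 , w' , Kw' , w'≉0 , ∼-trans Q∼W (∼-sym (κ , κ≉0 , W'≋κW))
    where
    A B C W A' B' C' : V3
    A = ℓ∞-point N a ; B = ℓ∞-point N b ; C = ℓ∞-point N c ; W = ℓ∞-point N w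
    A' = ℓ∞-point N' a' ; B' = ℓ∞-point N' b' ; C' = ℓ∞-point N' c'
    d x y d' x' y' s t : Carrier
    d = cross₂ a b ; x = cross₂ c b ; y = cross₂ a c
    d' = cross₂ a' b' ; x' = cross₂ c' b' ; y' = cross₂ a' c'
    s = cross₂ w b ; t = cross₂ a w

    A'∼A : A' ∼ A
    A'∼A = ∼-trans (∼-sym T∼A') T∼A
    B'∼B : B' ∼ B
    B'∼B = ∼-trans (∼-sym U∼B') U∼B
    C'∼C : C' ∼ C
    C'∼C = ∼-trans (∼-sym V∼C') V∼C
    γ : Carrier
    γ = proj₁ C'∼C

    d≉0 : d ≉ 0#
    d≉0 = cross₂-nonzero N-inv a≉0 b≉0 T∼A U∼B T≁U
    AB≉0 : third (cross A B) ≉ 0#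
    AB≉0 AB≈0 = *-nonzero N-inv d≉0 (trans (sym (proj₂ (proj₂ (cross-ℓ∞-point N a b)))) AB≈0)

    κ : Carrier
    κ = (d' * γ) * x * y
    κ≉0 : κ ≉ 0#
    κ≉0 = *-nonzero (*-nonzero (*-nonzero (cross₂-nonzero N'-inv a'≉0 b'≉0 T∼A' U∼B' T≁U) (proj₁ (proj₂ C'∼C)))
      (cross₂-nonzero N-inv c≉0 b≉0 V∼C U∼B (λ V∼U → U≁V (∼-sym V∼U))))
      (cross₂-nonzero N-inv a≉0 c≉0 T∼A V∼C T≁V)

    w' : V2
    w' = (s * x' * y) ·₂ a' ⊕₂ (t * y' * x) ·₂ b'
    Kw' : InK2 w'
    Kw' = K-·₂-⊕₂ (K-* (K-* (K-cross₂ Kw Kb) (K-cross₂ Kc' Kb')) (K-cross₂ Ka Kc)) Ka'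
                   (K-* (K-* (K-cross₂ Ka Kw) (K-cross₂ Ka' Kc')) (K-cross₂ Kc Kb)) Kb'

    W'≋κW : ℓ∞-point N' w' ≋ κ · W
    W'≋κW = ·-cancelˡ d≉0 (≋-trans (·-cong refl (ℓ∞-point-⊕ N' (s * x' * y) a' (t * y' * x) b'))
      (frame-transfer (proj₁ ratios) (proj₂ ratios) (proj₂ (proj₂ A'∼A)) (proj₂ (proj₂ B'∼B)) (ℓ∞-point-cramer N a b w)))
      where
      ratios = frame-ratios {x = x} {y} {x' = x'} {y'} AB≉0 (ℓ∞-point-cramer N a b c) (ℓ∞-point-cramer N' a' b' c')
        (proj₂ (proj₂ A'∼A)) (proj₂ (proj₂ B'∼B)) (proj₂ (proj₂ C'∼C))

    w'≉0 : NonZero2 w'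
    w'≉0 w'≋0 = ℓ∞-point-nonzero N-inv w≉0 (·-zero⇒zero κ≉0
      (≋-trans (≋-sym W'≋κW) (≋-trans (ℓ∞-point-cong N' w'≋0) (ℓ∞-point-zero N'))))

  subline-unique : ∀ {N N' T U V} → Invertible2 N → Invertible2 N' → Distinct3 T U V →
    OnSubline3 N T U V → OnSubline3 N' T U V → SameSet (OnSubline N) (OnSubline N')
  subline-unique N-inv N'-inv TUV N∋TUV N'∋TUV X =
    subline-⊆ N-inv N'-inv TUV N∋TUV N'∋TUV X , subline-⊆ N'-inv N-inv TUV N'∋TUV N∋TUV X

  three-points : ∀ {N} → Invertible2 N → Σ V3 λ Q₁ → Σ V3 λ Q₂ → Σ V3 λ Q₃ →
    OnSubline3 N Q₁ Q₂ Q₃ × Distinct3 Q₁ Q₂ Q₃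
  three-points {N} N-inv =
    ℓ∞-point N e₁ , ℓ∞-point N e₂ , ℓ∞-point N e₁₂ ,
    (on (K-1 , K-0) e₁≉0 , on (K-0 , K-1) e₂≉0 , on (K-1 , K-1) e₁₂≉0) ,
    apart (λ e → 1*1≉0 (trans (sym (solve 1 (λ o → :cross₂ (o , :0) (:0 , o) := o :* o) refl 1#)) e)) ,
    apart (λ e → 1*1≉0 (trans (sym (solve 1 (λ o → :cross₂ (o , :0) (o , o) := o :* o) refl 1#)) e)) ,
    apart (λ e → -‿nonzero 1*1≉0 (trans (sym (solve 1 (λ o → :cross₂ (:0 , o) (o , o) := :- (o :* o)) refl 1#)) e))
    where
    e₁ e₂ e₁₂ : V2
    e₁ = 1# , 0# ; e₂ = 0# , 1# ; e₁₂ = 1# , 1#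
    e₁≉0 : NonZero2 e₁
    e₁≉0 (1≈0 , _) = 1≉0 1≈0
    e₂≉0 : NonZero2 e₂
    e₂≉0 (_ , 1≈0) = 1≉0 1≈0
    e₁₂≉0 : NonZero2 e₁₂
    e₁₂≉0 (1≈0 , _) = 1≉0 1≈0
    on : ∀ {w} → InK2 w → NonZero2 w → OnSubline N (ℓ∞-point N w)
    on = OnSubline-ℓ∞-point N-inv
    apart : ∀ {u v} → cross₂ u v ≉ 0# → ¬ ℓ∞-point N u ∼ ℓ∞-point N v
    apart uv≉0 Nu∼Nv = uv≉0 (ℓ∞-point-∼⇒cross₂≈0 N-inv Nu∼Nv)

  pigeonhole : ∀ {a b} {A : V3 → Set a} {B : V3 → Set b} {Q₁ Q₂ Q₃} → Distinct3 Q₁ Q₂ Q₃ →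
    (∀ {X Y} → ¬ X ∼ Y → A X → A Y → ⊥) → (∀ {X Y} → ¬ X ∼ Y → B X → B Y → ⊥) →
    A Q₁ ⊎ B Q₁ → A Q₂ ⊎ B Q₂ → A Q₃ ⊎ B Q₃ → ⊥
  pigeonhole (Q₁≁Q₂ , _ , _)      A-once _      (inj₁ A₁) (inj₁ A₂) _         = A-once Q₁≁Q₂ A₁ A₂
  pigeonhole (Q₁≁Q₂ , _ , _)      _      B-once (inj₂ B₁) (inj₂ B₂) _         = B-once Q₁≁Q₂ B₁ B₂
  pigeonhole (_ , Q₁≁Q₃ , _)      A-once _      (inj₁ A₁) (inj₂ _)  (inj₁ A₃) = A-once Q₁≁Q₃ A₁ A₃
  pigeonhole (_ , _ , Q₂≁Q₃)      _      B-once (inj₁ _)  (inj₂ B₂) (inj₂ B₃) = B-once Q₂≁Q₃ B₂ B₃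
  pigeonhole (_ , _ , Q₂≁Q₃)      A-once _      (inj₂ _)  (inj₁ A₂) (inj₁ A₃) = A-once Q₂≁Q₃ A₂ A₃
  pigeonhole (_ , Q₁≁Q₃ , _)      _      B-once (inj₂ B₁) (inj₁ _)  (inj₂ B₃) = B-once Q₁≁Q₃ B₁ B₃

module TangentSubplane {c ℓ k : Level} (R : CommutativeRing c ℓ) (isField : Geometry.IsField R)
  (_≟_ : Decidable (CommutativeRing._≈_ R))
  (K : CommutativeRing.Carrier R → Set k) (isSubfield : Geometry.IsSubfield R K)
  (M : Geometry.Mat3 R) (M-inv : Geometry.Invertible3 R M)
  (T : Geometry.V3 R) (π∩ℓ∞ : Geometry.Sub.MeetsInfExactlyAt R K M T) where

  open CommutativeRing R hiding (zero)
  open Geometry R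
  open Sub K
  open Coordinates R
  open ProjectivePlane R isField _≟_
  open Subgeometry R isField _≟_ K isSubfield
  open import Algebra.Properties.Ring ring using (-‿distribʳ-*)

  T∈π : InPi M T
  T∈π = proj₁ π∩ℓ∞

  T∈ℓ∞ : OnInf T
  T∈ℓ∞ = proj₁ (proj₂ π∩ℓ∞)

  T≉0 : NonZero3 T
  T≉0 = proj₁ T∈ℓ∞

  π∩ℓ∞⊆T : ∀ {X} → InPi M X → OnInf X → X ∼ T
  π∩ℓ∞⊆T = proj₂ (proj₂ π∩ℓ∞) _

  InPi-app3 : ∀ {v} → InK3 v → NonZero3 v → InPi M (app3 M v)
  InPi-app3 Kv v≉0 = app3-nonzero M-inv v≉0 , _ , Kv , v≉0 , ∼-refl

  InPi-∼ : ∀ {X Y} → NonZero3 X → X ∼ Y → InPi M Y → InPi M X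
  InPi-∼ X≉0 X∼Y (_ , v , Kv , v≉0 , Y∼Mv) = X≉0 , v , Kv , v≉0 , ∼-trans X∼Y Y∼Mv

  line-of-π≁ℓ∞ : ∀ {L} → LineOfPi M L → ¬ L ∼ e₃
  line-of-π≁ℓ∞ (_ , X , Y , X∈π , Y∈π , X≁Y , LX≈0 , LY≈0) L∼e₃ =
    X≁Y (∼-trans (on-ℓ∞ X∈π LX≈0) (∼-sym (on-ℓ∞ Y∈π LY≈0)))
    where
    on-ℓ∞ : ∀ {Z} → InPi M Z → Incident _ Z → Z ∼ T
    on-ℓ∞ Z∈π LZ≈0 = π∩ℓ∞⊆T Z∈π (incident-e₃⇒OnInf (proj₁ Z∈π) (incident-∼ˡ LZ≈0 (∼-sym L∼e₃)))

  SpannedByπ : V3 → Set (c ⊔ ℓ ⊔ k)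
  SpannedByπ L = ∃₂ λ x y → InK3 x × InK3 y × L ∼ cross (app3 M x) (app3 M y)

  line-of-π-coordinates : ∀ {L} → LineOfPi M L → SpannedByπ L
  line-of-π-coordinates (L≉0 , X , Y , (X≉0 , x , Kx , _ , X∼Mx) , (Y≉0 , y , Ky , _ , Y∼My) , X≁Y , LX≈0 , LY≈0) =
    x , y , Kx , Ky , ∼-trans (line-through X≉0 Y≉0 X≁Y L≉0 LX≈0 LY≈0) (cross-∼ X∼Mx Y∼My)

  -- X₁Y₁ ∩ X₂Y₂ = det(X₁,Y₁,Y₂) X₂ − det(X₁,Y₁,X₂) Y₂, and each determinant is det3 M times one in K.
  meet-in-π : ∀ {L₁ L₂} → SpannedByπ L₁ → SpannedByπ L₂ → NonZero3 (cross L₁ L₂) → InPi M (cross L₁ L₂)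
  meet-in-π {L₁} {L₂} (x₁ , y₁ , Kx₁ , Ky₁ , L₁∼X₁Y₁) (x₂ , y₂ , Kx₂ , Ky₂ , L₂∼X₂Y₂) L₁L₂≉0 =
    InPi-∼ L₁L₂≉0 L₁L₂∼Mw (InPi-app3 Kw w≉0)
    where
    open ≋-Reasoning
    X₁ Y₁ X₂ Y₂ w : V3
    X₁ = app3 M x₁ ; Y₁ = app3 M y₁ ; X₂ = app3 M x₂ ; Y₂ = app3 M y₂
    k₁ k₂ : Carrier
    k₁ = det x₁ y₁ y₂ ; k₂ = det x₁ y₁ x₂
    w = k₁ · x₂ ⊕ - k₂ · y₂

    Kw : InK3 w
    Kw = K-·-⊕ (K-det Kx₁ Ky₁ Ky₂) Kx₂ (K-‿ (K-det Kx₁ Ky₁ Kx₂)) Ky₂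

    meet≋ : cross (cross X₁ Y₁) (cross X₂ Y₂) ≋ det3 M · app3 M w
    meet≋ = begin
      cross (cross X₁ Y₁) (cross X₂ Y₂)                 ≈⟨ cross-cross (cross X₁ Y₁) X₂ Y₂ ⟩
      det X₁ Y₁ Y₂ · X₂ ⊕ - det X₁ Y₁ X₂ · Y₂             ≈⟨ ⊕-cong (·-cong (det-app3 M x₁ y₁ y₂) ≋-refl)
                                                              (·-cong (-‿cong (det-app3 M x₁ y₁ x₂)) ≋-refl) ⟩
      (det3 M * k₁) · X₂ ⊕ - (det3 M * k₂) · Y₂          ≈⟨ ⊕-cong ≋-refl (·-cong (-‿distribʳ-* (det3 M) k₂) ≋-refl) ⟩
      (det3 M * k₁) · X₂ ⊕ (det3 M * - k₂) · Y₂          ≈⟨ ·-distrib-⊕ (det3 M) k₁ X₂ (- k₂) Y₂ ⟨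
      det3 M · (k₁ · X₂ ⊕ - k₂ · Y₂)                     ≈⟨ ·-cong refl (app3-⊕ M k₁ x₂ (- k₂) y₂) ⟨
      det3 M · app3 M w                                  ∎

    L₁L₂∼Mw : cross L₁ L₂ ∼ app3 M w
    L₁L₂∼Mw = ∼-trans (∼-≋ (cross-∼ L₁∼X₁Y₁ L₂∼X₂Y₂) meet≋) (·-∼ (app3 M w) M-inv)

    w≉0 : NonZero3 w
    w≉0 w≋0 = nonzero-∼ L₁L₂≉0 (∼-≋ L₁L₂∼Mw (≋-trans (app3-cong M w≋0) (app3-zero M))) ≋-refl

  lines-of-π-meet-in-π : ∀ {L₁ L₂} → LineOfPi M L₁ → LineOfPi M L₂ → ¬ L₁ ∼ L₂ → InPi M (cross L₁ L₂)
  lines-of-π-meet-in-π l₁ l₂ L₁≁L₂ =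
    meet-in-π (line-of-π-coordinates l₁) (line-of-π-coordinates l₂) (cross-nonzero (proj₁ l₁) (proj₁ l₂) L₁≁L₂)

  second-point : ∀ {L P} → InPi M P → LineOfPi M L → Incident L P →
    Σ V3 λ Y → InPi M Y × ¬ P ∼ Y × Incident L Y
  second-point P∈π (_ , Y₁ , Y₂ , Y₁∈π , Y₂∈π , Y₁≁Y₂ , LY₁ , LY₂) _ with ∼? (proj₁ P∈π) (proj₁ Y₁∈π)
  ... | yes P∼Y₁ = Y₂ , Y₂∈π , (λ P∼Y₂ → Y₁≁Y₂ (∼-trans (∼-sym P∼Y₁) P∼Y₂)) , LY₂
  ... | no P≁Y₁  = Y₁ , Y₁∈π , P≁Y₁ , LY₁

  module Pencil {P} (P∈π : InPi M P) (P≁T : ¬ P ∼ T) where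

    P≉0 : NonZero3 P
    P≉0 = proj₁ P∈π

    p : V3
    p = proj₁ (proj₂ P∈π)

    Kp : InK3 p
    Kp = proj₁ (proj₂ (proj₂ P∈π))

    p≉0 : NonZero3 p
    p≉0 = proj₁ (proj₂ (proj₂ (proj₂ P∈π)))

    Mp : V3
    Mp = app3 M p

    P∼Mp : P ∼ Mp
    P∼Mp = proj₂ (proj₂ (proj₂ (proj₂ P∈π)))

    -- the third row of M: the third coordinate of app3 M v is ρ v
    r : V3
    r = proj₂ (proj₂ M)

    ρ : V3 → Carrier
    ρ = dot3 r

    ρp≉0 : ρ p ≉ 0#
    ρp≉0 ρp≈0 = P≁T (∼-trans P∼Mp (π∩ℓ∞⊆T (InPi-app3 Kp p≉0) (app3-nonzero M-inv p≉0 , ρp≈0)))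

    -- where the line through P and app3 M u meets ℓ∞
    shadow : V3 → V3
    shadow u = app3 M (project r p u)

    shadow-on-ℓ∞ : ∀ u → third (shadow u) ≈ 0#
    shadow-on-ℓ∞ u = dot3-project r p u

    shadow≋ : ∀ u → shadow u ≋ ρ u · Mp ⊕ - ρ p · app3 M u
    shadow≋ u = app3-⊕ M (ρ u) p (- ρ p) u

    shadow-on-line : ∀ u → Incident (cross Mp (app3 M u)) (shadow u)
    shadow-on-line u = incident-≋ (dot3-cross-⊕ Mp (app3 M u) (ρ u) (- ρ p)) (shadow≋ u)

    cross-shadow : ∀ u → cross Mp (shadow u) ≋ - ρ p · cross Mp (app3 M u)
    cross-shadow u = ≋-trans (cross-cong ≋-refl (shadow≋ u)) (cross-⊕ʳ Mp (ρ u) (- ρ p) (app3 M u))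

    shadow≉0⇒line≉0 : ∀ {u} → NonZero3 (shadow u) → NonZero3 (cross Mp (app3 M u))
    shadow≉0⇒line≉0 {u} shadow≉0 line≋0 = ρp≉0 (third≈0-∼ Mp∼shadow (shadow-on-ℓ∞ u))
      where
      Mp∼shadow : Mp ∼ shadow u
      Mp∼shadow = cross≋0⇒∼ (app3-nonzero M-inv p≉0) shadow≉0
        (≋-trans (cross-shadow u) (≋-trans (·-cong refl line≋0) (·-zeroʳ _)))

    line≉0⇒shadow≉0 : ∀ {u} → NonZero3 (cross Mp (app3 M u)) → NonZero3 (shadow u)
    line≉0⇒shadow≉0 {u} line≉0 shadow≋0 = line≉0 (·-zero⇒zero (-‿nonzero ρp≉0)
      (≋-trans (≋-sym (cross-shadow u)) (≋-trans (cross-cong ≋-refl shadow≋0) (cross-zeroʳ Mp))))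

    pencil-line : ∀ {u} → InK3 u → NonZero3 (cross Mp (app3 M u)) →
      LineOfPi M (cross Mp (app3 M u)) × Incident (cross Mp (app3 M u)) P
    pencil-line {u} Ku line≉0 =
      (line≉0 , P , app3 M u , P∈π , InPi-app3 Ku u≉0 , P≁Mu , LP , dot3-crossʳ Mp (app3 M u)) , LP
      where
      LP : Incident (cross Mp (app3 M u)) P
      LP = incident-∼ʳ (dot3-crossˡ Mp (app3 M u)) P∼Mp
      Mu≉0 : NonZero3 (app3 M u)
      Mu≉0 Mu≋0 = line≉0 (≋-trans (cross-cong ≋-refl Mu≋0) (cross-zeroʳ Mp))
      u≉0 : NonZero3 u
      u≉0 u≋0 = Mu≉0 (≋-trans (app3-cong M u≋0) (app3-zero M))
      P≁Mu : ¬ P ∼ app3 M u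
      P≁Mu P∼Mu = line≉0 (∼⇒cross≋0 (∼-trans (∼-sym P∼Mp) P∼Mu))

    frame : ∃₂ λ i j → det (basis i) (basis j) p ≉ 0#
    frame = complement p≉0

    a b : V3
    a = basis (proj₁ frame)
    b = basis (proj₁ (proj₂ frame))

    Ka : InK3 a
    Ka = K-basis (proj₁ frame)

    Kb : InK3 b
    Kb = K-basis (proj₁ (proj₂ frame))

    d : Carrier
    d = det a b p

    d≉0 : d ≉ 0#
    d≉0 = proj₂ (proj₂ frame)

    N : Mat2
    N = columns (shadow a) (shadow b)

    ℓ∞-point-N : ∀ s t → ℓ∞-point N (s , t) ≋ s · shadow a ⊕ t · shadow b
    ℓ∞-point-N s t = ℓ∞-point-columns s t (shadow-on-ℓ∞ a) (shadow-on-ℓ∞ b)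

    shadow-⊕ : ∀ s t → shadow (s · a ⊕ t · b) ≋ ℓ∞-point N (s , t)
    shadow-⊕ s t = begin
      app3 M (project r p (s · a ⊕ t · b))                  ≈⟨ app3-cong M (project-⊕ r p s a t b) ⟩
      app3 M (s · project r p a ⊕ t · project r p b)        ≈⟨ app3-⊕ M s (project r p a) t (project r p b) ⟩
      s · shadow a ⊕ t · shadow b                           ≈⟨ ℓ∞-point-N s t ⟨
      ℓ∞-point N (s , t)                                    ∎
      where open ≋-Reasoning

    shadow-cramer : ∀ u → d · shadow u ≋ ℓ∞-point N (det u b p , det a u p)
    shadow-cramer u = begin
      d · app3 M (project r p u)                                    ≈⟨ app3-· M d (project r p u) ⟨
      app3 M (d · project r p u)                                    ≈⟨ app3-cong M (project-cramer r p a b u) ⟩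
      app3 M (det u b p · project r p a ⊕ det a u p · project r p b) ≈⟨ app3-⊕ M _ (project r p a) _ (project r p b) ⟩
      det u b p · shadow a ⊕ det a u p · shadow b                   ≈⟨ ℓ∞-point-N _ _ ⟨
      ℓ∞-point N (det u b p , det a u p)                            ∎
      where open ≋-Reasoning

    N-invertible : Invertible2 N
    N-invertible det2N≈0 = *-nonzero M-inv (*-nonzero (*-nonzero ρp≉0 ρp≉0) d≉0) (begin
      det3 M * ((ρ p * ρ p) * d)                       ≈⟨ *-congˡ (det-project r p a b) ⟨
      det3 M * det (project r p a) (project r p b) p   ≈⟨ det-app3 M (project r p a) (project r p b) p ⟨
      det (shadow a) (shadow b) Mp                     ≈⟨ dot3-cong (cross-cong (flatten a) (flatten b)) ≋-refl ⟩
      det (A₁ , A₂ , 0#) (B₁ , B₂ , 0#) Mp             ≈⟨ det-on-ℓ∞ A₁ A₂ B₁ B₂ _ _ _ ⟩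
      det2 N * ρ p                                     ≈⟨ *-congʳ det2N≈0 ⟩
      0# * ρ p                                         ≈⟨ zeroˡ (ρ p) ⟩
      0#                                               ∎)
      where
      open ≈-Reasoning
      A₁ = proj₁ (shadow a) ; A₂ = proj₁ (proj₂ (shadow a))
      B₁ = proj₁ (shadow b) ; B₂ = proj₁ (proj₂ (shadow b))
      flatten : ∀ u → shadow u ≋ (proj₁ (shadow u) , proj₁ (proj₂ (shadow u)) , 0#)
      flatten u = refl , refl , shadow-on-ℓ∞ u

    tP⊆subline : Subset (tP M P) (OnSubline N)
    tP⊆subline X (X∈ℓ∞ , L , l , LP , LX) =
      proj₁ X∈ℓ∞ , w , (K-det Ku Kb Kp , K-det Ka Ku Kp) , w≉0 , X∼Nw
      where
      Y = proj₁ (second-point P∈π l LP)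
      Y∈π = proj₁ (proj₂ (second-point P∈π l LP))
      P≁Y = proj₁ (proj₂ (proj₂ (second-point P∈π l LP)))
      LY = proj₂ (proj₂ (proj₂ (second-point P∈π l LP)))
      u : V3
      u = proj₁ (proj₂ Y∈π)
      Ku : InK3 u
      Ku = proj₁ (proj₂ (proj₂ Y∈π))
      w : V2
      w = det u b p , det a u p

      L∼line : L ∼ cross Mp (app3 M u)
      L∼line = ∼-trans (line-through P≉0 (proj₁ Y∈π) P≁Y (proj₁ l) LP LY)
                       (cross-∼ P∼Mp (proj₂ (proj₂ (proj₂ (proj₂ Y∈π)))))
      shadow≉0 : NonZero3 (shadow u)
      shadow≉0 = line≉0⇒shadow≉0 (nonzero-∼ (proj₁ l) L∼line)
      on-L-and-ℓ∞ : ∀ {Z} → NonZero3 Z → Incident L Z → OnInf Z → Z ∼ cross L e₃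
      on-L-and-ℓ∞ Z≉0 LZ Z∈ℓ∞ = meet-point (proj₁ l) e₃≉0 (line-of-π≁ℓ∞ l) Z≉0 LZ (OnInf⇒incident-e₃ Z∈ℓ∞)
      X∼shadow : X ∼ shadow u
      X∼shadow = ∼-trans (on-L-and-ℓ∞ (proj₁ X∈ℓ∞) LX X∈ℓ∞)
        (∼-sym (on-L-and-ℓ∞ shadow≉0 (incident-∼ˡ (shadow-on-line u) L∼line) (shadow≉0 , shadow-on-ℓ∞ u)))
      X∼Nw : X ∼ ℓ∞-point N w
      X∼Nw = ∼-≋ (∼-trans X∼shadow (∼-sym (·-∼ (shadow u) d≉0))) (shadow-cramer u)
      w≉0 : NonZero2 w
      w≉0 w≋0 = nonzero-∼ (proj₁ X∈ℓ∞) X∼Nw (≋-trans (ℓ∞-point-cong N w≋0) (ℓ∞-point-zero N))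

    subline⊆tP : Subset (OnSubline N) (tP M P)
    subline⊆tP X X∈N@(X≉0 , (s , t) , (Ks , Kt) , w≉0 , X∼Nw) =
      OnSubline⇒OnInf X∈N , cross Mp (app3 M u) , proj₁ line , proj₂ line ,
      incident-∼ʳ (shadow-on-line u) (∼-≋ X∼Nw (≋-sym (shadow-⊕ s t)))
      where
      u = s · a ⊕ t · b
      shadow≉0 : NonZero3 (shadow u)
      shadow≉0 = nonzero-∼ (ℓ∞-point-nonzero N-invertible w≉0) (≋⇒∼ (≋-sym (shadow-⊕ s t)))
      line = pencil-line (K-·-⊕ Ks Ka Kt Kb) (shadow≉0⇒line≉0 shadow≉0)

    T∈tP : tP M P T
    T∈tP = T∈ℓ∞ , cross P T , line , dot3-crossˡ P T , dot3-crossʳ P T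
      where
      line : LineOfPi M (cross P T)
      line = cross-nonzero P≉0 T≉0 P≁T , P , T , P∈π , T∈π , P≁T , dot3-crossˡ P T , dot3-crossʳ P T

  tP⊆Splash : ∀ P → Subset (tP M P) (Splash M)
  tP⊆Splash P X (X∈ℓ∞ , L , l , _ , LX) = X∈ℓ∞ , L , l , LX

  tP-subline : ∀ P → InPi M P → ¬ P ∼ T → ∃ λ N → Invertible2 N × SameSet (tP M P) (OnSubline N)
  tP-subline P P∈π P≁T = N , N-invertible , λ X → tP⊆subline X , subline⊆tP X
    where open Pencil P∈π P≁T

  T∈tP : ∀ {P} → InPi M P → ¬ P ∼ T → tP M P T
  T∈tP P∈π P≁T = Pencil.T∈tP P∈π P≁T

  line-of-π-meets-ℓ∞-once : ∀ {L X Y} → LineOfPi M L → OnInf X → OnInf Y → ¬ X ∼ Y →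
    Incident L X → Incident L Y → ⊥
  line-of-π-meets-ℓ∞-once l X∈ℓ∞ Y∈ℓ∞ X≁Y LX LY = line-of-π≁ℓ∞ l (∼-trans
    (line-through (proj₁ X∈ℓ∞) (proj₁ Y∈ℓ∞) X≁Y (proj₁ l) LX LY)
    (∼-sym (line-through (proj₁ X∈ℓ∞) (proj₁ Y∈ℓ∞) X≁Y e₃≉0 (OnInf⇒incident-e₃ X∈ℓ∞) (OnInf⇒incident-e₃ Y∈ℓ∞))))

  pencil-through : ∀ {U V} → Splash M U → Splash M V → ¬ T ∼ U → ¬ U ∼ V →
    Σ V3 λ P → InPi M P × ¬ P ∼ T × tP M P U × tP M P V
  pencil-through {U} {V} (U∈ℓ∞ , u , lu , uU) (V∈ℓ∞ , v , lv , vV) T≁U U≁V =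
    cross u v , lines-of-π-meet-in-π lu lv u≁v , P≁T , (U∈ℓ∞ , u , lu , uP , uU) , (V∈ℓ∞ , v , lv , vP , vV)
    where
    uP : Incident u (cross u v)
    uP = trans (dot3-comm u (cross u v)) (dot3-crossˡ u v)
    vP : Incident v (cross u v)
    vP = trans (dot3-comm v (cross u v)) (dot3-crossʳ u v)
    u≁v : ¬ u ∼ v
    u≁v u∼v = line-of-π-meets-ℓ∞-once lv U∈ℓ∞ V∈ℓ∞ U≁V (incident-∼ˡ uU (∼-sym u∼v)) vV
    P≁T : ¬ cross u v ∼ T
    P≁T P∼T = line-of-π-meets-ℓ∞-once lu T∈ℓ∞ U∈ℓ∞ T≁U (incident-∼ʳ uP (∼-sym P∼T)) uU

  pencil-subline : ∀ {N U V} → Invertible2 N → Distinct3 T U V → OnSubline3 N T U V →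
    Splash M U → Splash M V → Σ V3 λ P → InPi M P × ¬ P ∼ T × SameSet (tP M P) (OnSubline N)
  pencil-subline {N} {U} {V} N-inv TUV@(T≁U , _ , U≁V) N∋TUV U∈S V∈S =
    P , P∈π , P≁T , λ X → (λ X∈tP → proj₁ (N'≡N X) (proj₁ (tP≡N' X) X∈tP)) ,
                          (λ X∈N → proj₂ (tP≡N' X) (proj₂ (N'≡N X) X∈N))
    where
    pencil = pencil-through U∈S V∈S T≁U U≁V
    P = proj₁ pencil
    P∈π = proj₁ (proj₂ pencil)
    P≁T = proj₁ (proj₂ (proj₂ pencil))
    subline = tP-subline P P∈π P≁T
    tP≡N' = proj₂ (proj₂ subline)
    N'≡N = subline-unique (proj₁ (proj₂ subline)) N-inv TUV
      (proj₁ (tP≡N' T) (T∈tP P∈π P≁T) , proj₁ (tP≡N' U) (proj₁ (proj₂ (proj₂ (proj₂ pencil)))) ,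
       proj₁ (tP≡N' V) (proj₂ (proj₂ (proj₂ (proj₂ pencil)))))
      N∋TUV

  part2 : Part2 M T
  part2 U V U∈S V∈S U≁T V≁T U≁V N N-inv N∋T N∋U N∋V X X∈N =
    tP⊆Splash P X (proj₂ (proj₂ (proj₂ (proj₂ pencil)) X) X∈N)
    where
    pencil = pencil-subline N-inv ((λ T∼U → U≁T (∼-sym T∼U)) , (λ T∼V → V≁T (∼-sym T∼V)) , U≁V)
                            (N∋T , N∋U , N∋V) U∈S V∈S
    P = proj₁ pencil

  tP-surjective : ∀ N → Invertible2 N → OnSubline N T → Subset (OnSubline N) (Splash M) →
    ∃ λ P → InPi M P × ¬ P ∼ T × SameSet (tP M P) (OnSubline N)
  tP-surjective N N-inv N∋T N⊆S = avoid-T (three-points N-inv)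
    where
    Goal = ∃ λ P → InPi M P × ¬ P ∼ T × SameSet (tP M P) (OnSubline N)
    through : ∀ {U V} → OnSubline N U → OnSubline N V → ¬ T ∼ U → ¬ T ∼ V → ¬ U ∼ V → Goal
    through N∋U N∋V T≁U T≁V U≁V =
      pencil-subline N-inv (T≁U , T≁V , U≁V) (N∋T , N∋U , N∋V) (N⊆S _ N∋U) (N⊆S _ N∋V)
    avoid-T : (Σ V3 λ Q₁ → Σ V3 λ Q₂ → Σ V3 λ Q₃ → OnSubline3 N Q₁ Q₂ Q₃ × Distinct3 Q₁ Q₂ Q₃) → Goal
    avoid-T (_ , _ , _ , (N∋Q₁ , N∋Q₂ , N∋Q₃) , (Q₁≁Q₂ , Q₁≁Q₃ , Q₂≁Q₃))
      with ∼? T≉0 (proj₁ N∋Q₁) | ∼? T≉0 (proj₁ N∋Q₂)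
    ... | yes T∼Q₁ | _        = through N∋Q₂ N∋Q₃ (λ T∼Q₂ → Q₁≁Q₂ (∼-trans (∼-sym T∼Q₁) T∼Q₂))
                                  (λ T∼Q₃ → Q₁≁Q₃ (∼-trans (∼-sym T∼Q₁) T∼Q₃)) Q₂≁Q₃
    ... | no T≁Q₁  | yes T∼Q₂ = through N∋Q₁ N∋Q₃ T≁Q₁ (λ T∼Q₃ → Q₂≁Q₃ (∼-trans (∼-sym T∼Q₂) T∼Q₃)) Q₁≁Q₃
    ... | no T≁Q₁  | no T≁Q₂  = through N∋Q₁ N∋Q₂ T≁Q₁ T≁Q₂ Q₁≁Q₂

  tP-injective : ∀ P Q → InPi M P → InPi M Q → ¬ P ∼ T → ¬ Q ∼ T → SameSet (tP M P) (tP M Q) → P ∼ Q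
  tP-injective P Q P∈π Q∈π P≁T Q≁T tP≡tQ = decidable-stable (∼? (proj₁ P∈π) (proj₁ Q∈π)) λ P≁Q →
    pigeonhole distinct T-once (PQ-once P≁Q) (classify P≁Q N∋Q₁) (classify P≁Q N∋Q₂) (classify P≁Q N∋Q₃)
    where
    subline = tP-subline P P∈π P≁T
    N = proj₁ subline
    tP≡N = proj₂ (proj₂ subline)
    points = three-points (proj₁ (proj₂ subline))
    N∋Q₁ = proj₁ (proj₁ (proj₂ (proj₂ (proj₂ points))))
    N∋Q₂ = proj₁ (proj₂ (proj₁ (proj₂ (proj₂ (proj₂ points)))))
    N∋Q₃ = proj₂ (proj₂ (proj₁ (proj₂ (proj₂ (proj₂ points)))))
    distinct = proj₂ (proj₂ (proj₂ (proj₂ points)))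

    T-once : ∀ {X Y} → ¬ X ∼ Y → X ∼ T → Y ∼ T → ⊥
    T-once X≁Y X∼T Y∼T = X≁Y (∼-trans X∼T (∼-sym Y∼T))

    OnPQ : V3 → Set ℓ
    OnPQ X = OnInf X × Incident (cross P Q) X

    PQ-once : ¬ P ∼ Q → ∀ {X Y} → ¬ X ∼ Y → OnPQ X → OnPQ Y → ⊥
    PQ-once P≁Q X≁Y (X∈ℓ∞ , PQX) (Y∈ℓ∞ , PQY) = line-of-π-meets-ℓ∞-once
      (cross-nonzero (proj₁ P∈π) (proj₁ Q∈π) P≁Q , P , Q , P∈π , Q∈π , P≁Q , dot3-crossˡ P Q , dot3-crossʳ P Q)
      X∈ℓ∞ Y∈ℓ∞ X≁Y PQX PQY

    -- a point of t_P = t_Q off the line PQ lies on two distinct lines of π, hence in π ∩ ℓ∞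
    classify : ¬ P ∼ Q → ∀ {X} → OnSubline N X → X ∼ T ⊎ OnPQ X
    classify P≁Q {X} N∋X with ∼? (proj₁ N∋X) T≉0
    ... | yes X∼T = inj₁ X∼T
    ... | no X≁T  = inj₂ (X∈ℓ∞ , decidable-stable (dot3 (cross P Q) X ≟ 0#) λ X∉PQ →
                      X≁T (π∩ℓ∞⊆T (X∈π X∉PQ) X∈ℓ∞))
      where
      X∈tP = proj₂ (tP≡N X) N∋X
      X∈tQ = proj₁ (tP≡tQ X) X∈tP
      X∈ℓ∞ = proj₁ X∈tP
      X≉0 = proj₁ X∈ℓ∞
      L₁ = proj₁ (proj₂ X∈tP) ; l₁ = proj₁ (proj₂ (proj₂ X∈tP))
      L₁P = proj₁ (proj₂ (proj₂ (proj₂ X∈tP))) ; L₁X = proj₂ (proj₂ (proj₂ (proj₂ X∈tP)))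
      L₂ = proj₁ (proj₂ X∈tQ) ; l₂ = proj₁ (proj₂ (proj₂ X∈tQ))
      L₂Q = proj₁ (proj₂ (proj₂ (proj₂ X∈tQ))) ; L₂X = proj₂ (proj₂ (proj₂ (proj₂ X∈tQ)))
      X∈π : ¬ Incident (cross P Q) X → InPi M X
      X∈π X∉PQ = InPi-∼ X≉0 (meet-point (proj₁ l₁) (proj₁ l₂) L₁≁L₂ X≉0 L₁X L₂X) (lines-of-π-meet-in-π l₁ l₂ L₁≁L₂)
        where
        L₁≁L₂ : ¬ L₁ ∼ L₂
        L₁≁L₂ L₁∼L₂ = X∉PQ (incident-∼ˡ L₁X (∼-sym (line-through (proj₁ P∈π) (proj₁ Q∈π) P≁Q (proj₁ l₁) L₁P
                                                    (incident-∼ˡ L₂Q L₁∼L₂))))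

  part1 : Part1 M T
  part1 = (λ P P∈π P≁T → tP-subline P P∈π P≁T , T∈tP P∈π P≁T , tP⊆Splash P) , tP-injective , tP-surjective

module _ {c ℓ : Level} (R : CommutativeRing c ℓ) where
  open CommutativeRing R

  HasSize⇒≈-decidable : ∀ {n} → Geometry.HasSize R n → Decidable _≈_
  HasSize⇒≈-decidable (e , e-injective , e-surjective) x y
    with e-surjective x | e-surjective y
  ... | i , eᵢ≈x | j , eⱼ≈y with i Fin.≟ j
  ...   | yes ≡.refl = yes (trans (sym eᵢ≈x) eⱼ≈y)
  ...   | no i≢j     = no λ x≈y → i≢j (e-injective i j (trans eᵢ≈x (trans x≈y (sym eⱼ≈y))))

-- Finiteness of R is used only to decide equality.
lemma3p1 : ∀ {c ℓ k : Level} (R : CommutativeRing c ℓ) (q : ℕ) →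
    IsPrimePower q →
    Geometry.IsField R → Geometry.HasSize R (q ^ 3) →
    (K : CommutativeRing.Carrier R → Set k) →
    Geometry.IsSubfield R K → Geometry.SubHasSize R K q →
    (M : Geometry.Mat3 R) → Geometry.Invertible3 R M →
    (T : Geometry.V3 R) → Geometry.Sub.MeetsInfExactlyAt R K M T →
    Geometry.Sub.Part1 R K M T × Geometry.Sub.Part2 R K M T
lemma3p1 R q _ isField R-finite K isSubfield _ M M-inv T π∩ℓ∞ = part1 , part2
  where open TangentSubplane R isField (HasSize⇒≈-decidable R R-finite) K isSubfield M M-inv T π∩ℓ∞
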